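{- Let $r,s,n$ be positive integers and let $\mathbb{F}_2[\mathbf{x}]$ be the polynomial ring over the field $\mathbb{F}_2$ in the $rsn$ variables $\mathbf{x}=\{x_{ijk}: i\in[r], j\in[s], k\in[n]\}$. Let $I_{r,s,n}$ be the ideal of $\mathbb{F}_2[\mathbf{x}]$ generated by the polynomials $x_{ijk}(x_{ijk}-1)$, $x_{ijk}x_{i'jk}$, $x_{ijk}x_{ij'k}$, $x_{ijk}x_{ijk'}$ for all $i\in[r]$, $j\in[s]$, $k\in[n]$, $i'\in\{i+1,\ldots,r\}$, $j'\in\{j+1,\ldots,s\}$, $k'\in\{k+1,\ldots,n\}$. Then the map sending a partial Latin rectangle $P=(p_{ij})\in\mathcal{R}_{r,s,n}$ to the point of $\mathbb{F}_2^{rsn}$ with coordinates $x_{ijk}=1$ if $p_{ij}=k$ and $x_{ijk}=0$ otherwise is a bijection from $\mathcal{R}_{r,s,n}$ onto the set $V(I_{r,s,n})$ of common zeros of $I_{r,s,n}$. Moreover, $|\mathcal{R}_{r,s,n}|=\dim_{\mathbb{F}_2}(\mathbb{F}_2[\mathbf{x}]/I_{r,s,n})$ and, for every integer $m\geq 0$, $|\mathcal{R}_{r,s,n:m}|=\mathrm{HF}_{\mathbb{F}_2[\mathbf{x}]/I_{r,s,n}}(m)$.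
   Context: An $r\times s$ partial Latin rectangle based on $[n]=\{1,\ldots,n\}$ is an $r\times s$ array in which each cell is either empty or contains a symbol of $[n]$, such that each symbol occurs at most once in each row and in each column; its size is its number of filled cells. $\mathcal{R}_{r,s,n}$ is the set of all such arrays and $\mathcal{R}_{r,s,n:m}$ its subset of those of size $m$. For an ideal $I$ of a polynomial ring $R$ and a term order $<$ (here the lexicographic order), the initial ideal $I_<$ is generated by the leading monomials of the nonzero elements of $I$; a standard monomial of $I$ is a monomial not in $I_<$. The Hilbert function $\mathrm{HF}_{R/I}(d)$ is the number of standard monomials of $I$ of degree $d$ (the dimension of the degree-$d$ component of $R/I_<$). -}

module Defs where

open import Data.Nat using (ℕ; zero; suc; _+_; _<_)
import Data.Nat as ℕ
open import Data.Bool using (Bool; true; false; _xor_; _∧_; not; if_then_else_)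
open import Data.Fin using (Fin)
import Data.Fin as F
open import Data.Vec using (Vec; lookup; tabulate; zipWith; replicate)
import Data.Vec as V
import Data.Vec.Properties as VP
open import Data.List using (List; []; _∷_; _++_; map; concatMap)
import Data.List as L
import Data.Nat.ListAction as LA
open import Data.Maybe using (Maybe; just; nothing)
open import Data.Product using (Σ; _×_; _,_)
open import Data.Sum using (_⊎_)
open import Relation.Binary.PropositionalEquality using (_≡_)
open import Relation.Nullary using (¬_; does)

Card : {A : Set} → (A → Set) → ℕ → Set
Card {A} P N =
  Σ (Vec A N) λ v →
    (∀ i → P (lookup v i)) ×
    (∀ i j → lookup v i ≡ lookup v j → i ≡ j) ×
    (∀ a → P a → Σ (Fin N) λ i → lookup v i ≡ a)

Mon : ℕ → ℕ → ℕ → Set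
Mon r s n = Vec (Vec (Vec ℕ n) s) r

module _ {r s n : ℕ} where

  expo : Mon r s n → Fin r → Fin s → Fin n → ℕ
  expo μ i j k = lookup (lookup (lookup μ i) j) k

  _≟ₘ_ : (μ ν : Mon r s n) → Relation.Nullary.Dec (μ ≡ ν)
  _≟ₘ_ = VP.≡-dec (VP.≡-dec (VP.≡-dec ℕ._≟_))

  _*ₘ_ : Mon r s n → Mon r s n → Mon r s n
  _*ₘ_ = zipWith (zipWith (zipWith _+_))

  var : Fin r → Fin s → Fin n → Mon r s n
  var i j k = tabulate λ i' → tabulate λ j' → tabulate λ k' →
    if does (i F.≟ i') ∧ does (j F.≟ j') ∧ does (k F.≟ k') then 1 else 0

  -- exponents listed in the variable order
  -- x_{111} > x_{112} > … (lexicographic in (i,j,k))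
  flat : Mon r s n → List ℕ
  flat μ = L.concat (L.concat (V.toList (V.map (λ row → V.toList (V.map V.toList row)) μ)))

  deg : Mon r s n → ℕ
  deg μ = LA.sum (flat μ)

data LexLt : List ℕ → List ℕ → Set where
  here  : ∀ {a b xs ys} → a < b → LexLt (a ∷ xs) (b ∷ ys)
  there : ∀ {a xs ys} → LexLt xs ys → LexLt (a ∷ xs) (a ∷ ys)

module _ {r s n : ℕ} where

  _<ₘ_ : Mon r s n → Mon r s n → Set
  μ <ₘ ν = LexLt (flat μ) (flat ν)

-- Polynomials over 𝔽₂: formal sums of monomials (lists); the
-- coefficient of a monomial is the parity of its multiplicity.

Poly : ℕ → ℕ → ℕ → Set
Poly r s n = List (Mon r s n)

module _ {r s n : ℕ} where

  coeff : Poly r s n → Mon r s n → Bool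
  coeff p μ = L.foldr (λ ν b → if does (ν ≟ₘ μ) then not b else b) false p

  _≈ₚ_ : Poly r s n → Poly r s n → Set
  p ≈ₚ q = ∀ μ → coeff p μ ≡ coeff q μ

  _+ₚ_ : Poly r s n → Poly r s n → Poly r s n
  _+ₚ_ = _++_

  _*ₚ_ : Poly r s n → Poly r s n → Poly r s n
  p *ₚ q = concatMap (λ μ → map (μ *ₘ_) q) p

  sumₚ : List (Poly r s n) → Poly r s n
  sumₚ = L.foldr _+ₚ_ []

  _∈⟨_⟩ : Poly r s n → (Poly r s n → Set) → Set
  p ∈⟨ G ⟩ = Σ (List (Poly r s n × Σ (Poly r s n) G)) λ cs →
               p ≈ₚ sumₚ (map (λ { (q , g , _) → q *ₚ g }) cs)

  Point : Set
  Point = Vec (Vec (Vec Bool n) s) r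

  andV : ∀ {m} → Vec Bool m → Bool
  andV = V.foldr _ _∧_ true

  pw : Bool → ℕ → Bool
  pw b zero    = true
  pw b (suc _) = b

  evalMon : Point → Mon r s n → Bool
  evalMon a μ = andV (zipWith (λ ar μr → andV (zipWith (λ ac μc → andV (zipWith pw ac μc)) ar μr)) a μ)

  eval : Point → Poly r s n → Bool
  eval a p = L.foldr (λ μ b → evalMon a μ xor b) false p

  InV : (Poly r s n → Set) → Point → Set
  InV G a = ∀ f → f ∈⟨ G ⟩ → eval a f ≡ false

  -- leading monomial w.r.t. lex order (f ≠ 0 is forced by coeff f μ ≡ true)
  LM : Poly r s n → Mon r s n → Set
  LM f μ = coeff f μ ≡ true × (∀ ν → coeff f ν ≡ true → ν ≡ μ ⊎ ν <ₘ μ)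

  InitGens : (Poly r s n → Set) → Poly r s n → Set
  InitGens G p = Σ (Mon r s n) λ μ → (p ≡ μ ∷ []) × Σ (Poly r s n) λ f → (f ∈⟨ G ⟩) × LM f μ

  Standard : (Poly r s n → Set) → Mon r s n → Set
  Standard G μ = ¬ ((μ ∷ []) ∈⟨ InitGens G ⟩)

  HFis : (Poly r s n → Set) → ℕ → ℕ → Set
  HFis G d N = Card (λ μ → deg μ ≡ d × Standard G μ) N

  comb : ∀ {N} → Vec Bool N → Vec (Poly r s n) N → Poly r s n
  comb S b = V.foldr _ _++_ [] (zipWith (λ c p → if c then p else []) S b)

  DimQuot : (Poly r s n → Set) → ℕ → Set
  DimQuot G N = Σ (Vec (Poly r s n) N) λ b →
    (∀ p → Σ (Vec Bool N) λ S → (p +ₚ comb S b) ∈⟨ G ⟩) ×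
    (∀ S → comb S b ∈⟨ G ⟩ → S ≡ replicate N false)

data Gen (r s n : ℕ) : Set where
  gsq  : Fin r → Fin s → Fin n → Gen r s n
  gcol : (i i' : Fin r) (j : Fin s) (k : Fin n) → i F.< i' → Gen r s n
  grow : (i : Fin r) (j j' : Fin s) (k : Fin n) → j F.< j' → Gen r s n
  gsym : (i : Fin r) (j : Fin s) (k k' : Fin n) → k F.< k' → Gen r s n

module _ {r s n : ℕ} where

  -- over 𝔽₂, x(x-1) = x² + x
  gen : Gen r s n → Poly r s n
  gen (gsq i j k)          = (var i j k *ₘ var i j k) ∷ var i j k ∷ []
  gen (gcol i i' j k _)    = (var i j k *ₘ var i' j k) ∷ []
  gen (grow i j j' k _)    = (var i j k *ₘ var i j' k) ∷ []
  gen (gsym i j k k' _)    = (var i j k *ₘ var i j k') ∷ []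

IGens : (r s n : ℕ) → Poly r s n → Set
IGens r s n p = Σ (Gen r s n) λ g → gen g ≡ p

Rect : ℕ → ℕ → ℕ → Set
Rect r s n = Vec (Vec (Maybe (Fin n)) s) r

module _ {r s n : ℕ} where

  entry : Rect r s n → Fin r → Fin s → Maybe (Fin n)
  entry P i j = lookup (lookup P i) j

  IsPLR : Rect r s n → Set
  IsPLR P =
    (∀ i j j' k → entry P i j ≡ just k → entry P i j' ≡ just k → j ≡ j') ×
    (∀ i i' j k → entry P i j ≡ just k → entry P i' j ≡ just k → i ≡ i')

  filled : Maybe (Fin n) → ℕ
  filled nothing  = 0
  filled (just _) = 1

  size : Rect r s n → ℕ
  size P = V.sum (V.map (λ row → V.sum (V.map filled row)) P)

  isK : Maybe (Fin n) → Fin n → Bool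
  isK nothing   k = false
  isK (just k') k = does (k' F.≟ k)

  toPoint : Rect r s n → Point {r} {s} {n}
  toPoint P = tabulate λ i → tabulate λ j → tabulate λ k → isK (entry P i j) k

-- A point a ∈ 𝔽₂^{rsn} has a "conflict" when two coordinates equal to 1 are
-- multiplied by one of the quadratic generators x_{ijk}x_{i'jk}, x_{ijk}x_{ij'k},
-- x_{ijk}x_{ijk'}.  Conflict-free points are exactly the images of partial
-- Latin rectangles and exactly the zeros of I (module Variety).
--
-- For the algebra, x^a denotes the square-free monomial of a point a.  Using
-- x² ≡ x and the quadratic generators, every polynomial is congruent modulo I
-- to a combination of monomials x^a with a conflict-free (module Reduction).
-- Triangularity: at a conflict-free point a, the only such monomials that
-- evaluate to 1 are x^a and its proper divisors, so a combination of them
-- lying in I is zero.  Consequently no element of I has a leading monomial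
-- x^a with a conflict-free, and these monomials are exactly the standard
-- monomials (module InitialIdeal).  The monomials x^P of the partial Latin
-- rectangles P then form a basis of 𝔽₂[x]/I, and those with |P| = m are the
-- standard monomials of degree m (module Counting).

module Submission where

open import Defs
open import Data.Nat using (ℕ; _≤_)
open import Data.Product using (Σ; _×_)
open import Relation.Binary.PropositionalEquality using (_≡_)

open import Data.Nat using (zero; suc; _+_; _∸_; _<_; z≤n; s≤s; _≤?_) renaming (_≟_ to _≟ℕ_)
import Data.Nat.Properties as NP
open import Data.Nat.Induction using (<-rec)
import Data.Nat.ListAction as LA
import Data.Nat.ListAction.Properties as LAP
open import Data.Bool using (Bool; true; false; _xor_; _∧_; not; if_then_else_)
open import Data.Bool.Properties
  using (xor-assoc; xor-same; xor-identityʳ; ∧-zeroʳ; ∧-identityʳ; ∧-idem; ∧-conicalˡ; ∧-conicalʳ;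
         ∧-distribˡ-xor; ∧-distribʳ-xor)
import Data.Bool.Properties as BP
open import Data.Bool.Solver using (module xor-∧-Solver)
open import Data.Fin as F using (Fin)
import Data.Fin.Properties as FP
open import Data.Vec as V using (Vec; lookup; tabulate; zipWith; replicate; []; _∷_)
import Data.Vec.Properties as VP
open import Data.List as L using (List; map; concatMap; _++_)
import Data.List.Properties as LP
import Data.List.Relation.Binary.Pointwise as Pw
open import Data.Maybe using (Maybe; just; nothing)
open import Data.Product using (_,_; proj₁; proj₂; ∃)
open import Data.Sum using (_⊎_; inj₁; inj₂; [_,_]′)
open import Data.Empty using (⊥; ⊥-elim)
open import Relation.Binary using (DecidableEquality; tri<; tri≈; tri>)
open import Relation.Binary.PropositionalEquality
  using (refl; sym; trans; cong; cong₂; subst; subst₂; _≢_; module ≡-Reasoning)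
open import Relation.Nullary using (¬_; Dec; yes; no; does)
open import Relation.Nullary.Decidable using (_×-dec_; _⊎-dec_)
open import Data.List.Membership.Propositional using (_∈_)
import Data.List.Membership.Propositional.Properties as MemP
open import Data.List.Relation.Unary.Any using (here; there)
import Data.List.Relation.Unary.Any as Any
import Data.List.Relation.Unary.Any.Properties as AnyP
import Data.List.Relation.Unary.All as All
import Data.List.Relation.Unary.All.Properties as AllP
open import Data.List.Relation.Unary.AllPairs using () renaming ([] to []ᵃ; _∷_ to _∷ᵃ_)
open import Data.List.Relation.Unary.Unique.Propositional using (Unique)
import Data.List.Relation.Unary.Unique.Propositional.Properties as UniqueP

bool-ext : ∀ {b c : Bool} → (b ≡ true → c ≡ true) → (c ≡ true → b ≡ true) → b ≡ c
bool-ext {false} {false} _ _ = refl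
bool-ext {false} {true}  _ g = g refl
bool-ext {true}  {false} f _ = sym (f refl)
bool-ext {true}  {true}  _ _ = refl

∧-false : ∀ {b c} → (b ≡ true → c ≡ true → ⊥) → b ∧ c ≡ false
∧-false {false}         _ = refl
∧-false {true} {false}  _ = refl
∧-false {true} {true}   f = ⊥-elim (f refl refl)

xor-cancel : ∀ a b → a xor b ≡ false → a ≡ b
xor-cancel false false _ = refl
xor-cancel true  true  _ = refl

module _ where
  open xor-∧-Solver using (solve; _:+_; _:=_)

  xor-absorb : ∀ a b → a xor (a xor b) ≡ b
  xor-absorb = solve 2 (λ a b → a :+ (a :+ b) := b) refl

  xor-swap : ∀ a b c → a xor (b xor c) ≡ b xor (a xor c)
  xor-swap = solve 3 (λ a b c → a :+ (b :+ c) := b :+ (a :+ c)) refl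

  xor-interchange : ∀ a b c d → a xor (b xor (c xor d)) ≡ (a xor c) xor (b xor d)
  xor-interchange = solve 4 (λ a b c d → a :+ (b :+ (c :+ d)) := (a :+ c) :+ (b :+ d)) refl

true≢false : true ≢ false
true≢false ()

vec-ext : ∀ {A : Set} {m} {u v : Vec A m} → (∀ i → lookup u i ≡ lookup v i) → u ≡ v
vec-ext {u = u} {v} h =
  trans (sym (VP.tabulate∘lookup u)) (trans (VP.tabulate-cong h) (VP.tabulate∘lookup v))

-- The conjunction of a Boolean vector (this is Defs.andV, which carries
-- irrelevant dimension parameters) is true iff every entry is.
conj : ∀ {m} → Vec Bool m → Bool
conj = V.foldr _ _∧_ true

conj-true : ∀ {A B : Set} {m} (f : A → B → Bool) (u : Vec A m) (v : Vec B m) →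
  conj (zipWith f u v) ≡ true → ∀ i → f (lookup u i) (lookup v i) ≡ true
conj-true f (x ∷ u) (y ∷ v) p F.zero    = ∧-conicalˡ _ _ p
conj-true f (x ∷ u) (y ∷ v) p (F.suc i) = conj-true f u v (∧-conicalʳ (f x y) _ p) i

conj-intro : ∀ {A B : Set} {m} (f : A → B → Bool) (u : Vec A m) (v : Vec B m) →
  (∀ i → f (lookup u i) (lookup v i) ≡ true) → conj (zipWith f u v) ≡ true
conj-intro f []      []      _ = refl
conj-intro f (x ∷ u) (y ∷ v) h = cong₂ _∧_ (h F.zero) (conj-intro f u v (λ i → h (F.suc i)))

sum-map-mono : ∀ {A B : Set} {m} (h : A → ℕ) (g : B → ℕ) (u : Vec A m) (v : Vec B m) →
  (∀ i → h (lookup u i) ≤ g (lookup v i)) → V.sum (V.map h u) ≤ V.sum (V.map g v)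
sum-map-mono h g []      []      _ = z≤n
sum-map-mono h g (x ∷ u) (y ∷ v) f = NP.+-mono-≤ (f F.zero) (sum-map-mono h g u v (λ i → f (F.suc i)))

+-tight : ∀ {a b c d} → a ≤ b → c ≤ d → a + c ≡ b + d → a ≡ b × c ≡ d
+-tight {a} {b} {c} {d} a≤b c≤d e = a≡b , NP.+-cancelˡ-≡ a c d (trans e (cong (_+ d) (sym a≡b)))
  where
    a≡b : a ≡ b
    a≡b = NP.≤-antisym a≤b (NP.+-cancelʳ-≤ d b a (subst (_≤ a + d) e (NP.+-monoʳ-≤ a c≤d)))

sum-map-tight : ∀ {A B : Set} {m} (h : A → ℕ) (g : B → ℕ) (u : Vec A m) (v : Vec B m) →
  (∀ i → h (lookup u i) ≤ g (lookup v i)) → V.sum (V.map h u) ≡ V.sum (V.map g v) →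
  ∀ i → h (lookup u i) ≡ g (lookup v i)
sum-map-tight h g (x ∷ u) (y ∷ v) f e i with +-tight (f F.zero) (sum-map-mono h g u v (λ i → f (F.suc i))) e
sum-map-tight h g (x ∷ u) (y ∷ v) f e F.zero    | head≡ , _ = head≡
sum-map-tight h g (x ∷ u) (y ∷ v) f e (F.suc i) | _ , tail≡ = sum-map-tight h g u v (λ i → f (F.suc i)) tail≡ i

sum-map-cong : ∀ {A B : Set} {m} (h : A → ℕ) (g : B → ℕ) (u : Vec A m) (v : Vec B m) →
  (∀ i → h (lookup u i) ≡ g (lookup v i)) → V.sum (V.map h u) ≡ V.sum (V.map g v)
sum-map-cong h g []      []      _ = refl
sum-map-cong h g (x ∷ u) (y ∷ v) f = cong₂ _+_ (f F.zero) (sum-map-cong h g u v (λ i → f (F.suc i)))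

sum-map-tabulate-zero : ∀ {A : Set} {m} (h : A → ℕ) (f : Fin m → A) → (∀ t → h (f t) ≡ 0) →
  V.sum (V.map h (tabulate f)) ≡ 0
sum-map-tabulate-zero {m = zero}  h f _ = refl
sum-map-tabulate-zero {m = suc m} h f z =
  cong₂ _+_ (z F.zero) (sum-map-tabulate-zero h (λ t → f (F.suc t)) (λ t → z (F.suc t)))

sum-map-tabulate-single : ∀ {A : Set} {m} (h : A → ℕ) (f : Fin m → A) (t₀ : Fin m) →
  (∀ t → t ≢ t₀ → h (f t) ≡ 0) → V.sum (V.map h (tabulate f)) ≡ h (f t₀)
sum-map-tabulate-single {m = suc m} h f F.zero z =
  trans (cong (h (f F.zero) +_) (sum-map-tabulate-zero h (λ t → f (F.suc t)) (λ t → z (F.suc t) (λ ()))))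
        (NP.+-identityʳ _)
sum-map-tabulate-single {m = suc m} h f (F.suc t₀) z =
  cong₂ _+_ (z F.zero (λ ()))
    (sum-map-tabulate-single h (λ t → f (F.suc t)) t₀ (λ t t≢t₀ → z (F.suc t) (λ e → t≢t₀ (FP.suc-injective e))))

-- Parity sums.  A list xs of elements of A is a formal 𝔽₂-sum, and a map
-- h : A → 𝔽₂ extends linearly to  parity h xs = ⊕_{x ∈ xs} h x.

parity : {A : Set} → (A → Bool) → List A → Bool
parity h = L.foldr (λ x b → h x xor b) false

parity-++ : ∀ {A : Set} (h : A → Bool) xs ys → parity h (xs ++ ys) ≡ parity h xs xor parity h ys
parity-++ h L.[]       ys = refl
parity-++ h (x L.∷ xs) ys = trans (cong (h x xor_) (parity-++ h xs ys)) (sym (xor-assoc (h x) _ _))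

parity-concatMap : ∀ {A B : Set} (h : B → Bool) (f : A → List B) xs →
  parity h (concatMap f xs) ≡ parity (λ x → parity h (f x)) xs
parity-concatMap h f L.[]       = refl
parity-concatMap h f (x L.∷ xs) =
  trans (parity-++ h (f x) (concatMap f xs)) (cong (parity h (f x) xor_) (parity-concatMap h f xs))

parity-map : ∀ {A B : Set} (h : B → Bool) (f : A → B) xs → parity h (map f xs) ≡ parity (λ x → h (f x)) xs
parity-map h f L.[]       = refl
parity-map h f (x L.∷ xs) = cong (h (f x) xor_) (parity-map h f xs)

parity-cong : ∀ {A : Set} (h g : A → Bool) xs → (∀ x → h x ≡ g x) → parity h xs ≡ parity g xs
parity-cong h g L.[]       _ = refl
parity-cong h g (x L.∷ xs) e = cong₂ _xor_ (e x) (parity-cong h g xs e)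

parity-∧ˡ : ∀ {A : Set} (h : A → Bool) c xs → parity (λ x → c ∧ h x) xs ≡ c ∧ parity h xs
parity-∧ˡ h c L.[]       = sym (∧-zeroʳ c)
parity-∧ˡ h c (x L.∷ xs) = trans (cong ((c ∧ h x) xor_) (parity-∧ˡ h c xs)) (sym (∧-distribˡ-xor c (h x) _))

parity-∧ʳ : ∀ {A : Set} (h : A → Bool) c xs → parity (λ x → h x ∧ c) xs ≡ parity h xs ∧ c
parity-∧ʳ h c L.[]       = refl
parity-∧ʳ h c (x L.∷ xs) = trans (cong ((h x ∧ c) xor_) (parity-∧ʳ h c xs)) (sym (∧-distribʳ-xor c (h x) _))

parity-true : ∀ {A : Set} (h : A → Bool) xs → parity h xs ≡ true → Σ A λ x → h x ≡ true
parity-true h L.[] ()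
parity-true h (x L.∷ xs) e with h x in hx
... | true  = x , hx
... | false = parity-true h xs e

-- The
-- central fact is that parity sums depend only on these coefficients.
module Coefficients {A : Set} (_≟_ : DecidableEquality A) where

  coeffOf : List A → A → Bool
  coeffOf xs a = parity (λ x → does (x ≟ a)) xs

  does-refl : ∀ a → does (a ≟ a) ≡ true
  does-refl a with a ≟ a
  ... | yes _ = refl
  ... | no a≢a = ⊥-elim (a≢a refl)

  does-≢ : ∀ {a b} → a ≢ b → does (a ≟ b) ≡ false
  does-≢ {a} {b} a≢b with a ≟ b
  ... | yes a≡b = ⊥-elim (a≢b a≡b)
  ... | no _    = refl

  does-true : ∀ {a b} → does (a ≟ b) ≡ true → a ≡ b
  does-true {a} {b} e with a ≟ b
  ... | yes a≡b = a≡b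

  coeff-single : ∀ a b → coeffOf (a L.∷ L.[]) b ≡ does (a ≟ b)
  coeff-single a b = xor-identityʳ (does (a ≟ b))

  coeff-++ : ∀ xs ys a → coeffOf (xs ++ ys) a ≡ coeffOf xs a xor coeffOf ys a
  coeff-++ xs ys a = parity-++ (λ x → does (x ≟ a)) xs ys

  coeff-∈ : ∀ xs a → coeffOf xs a ≡ true → a ∈ xs
  coeff-∈ (x L.∷ xs) a e with x ≟ a
  ... | yes x≡a = here (sym x≡a)
  ... | no _    = there (coeff-∈ xs a e)

  extract : ∀ {a} xs → a ∈ xs →
    Σ (List A) λ ys → L.length xs ≡ suc (L.length ys) × (∀ h → parity h xs ≡ h a xor parity h ys)
  extract (x L.∷ xs) (here refl) = xs , refl , λ h → refl
  extract {a} (x L.∷ xs) (there a∈xs) with extract xs a∈xs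
  ... | ys , len , split =
    x L.∷ ys , cong suc len , λ h → trans (cong (h x xor_) (split h)) (xor-swap (h x) (h a) (parity h ys))

  -- A formal sum all of whose coefficients vanish is killed by every parity
  -- sum: cancel the head against a second occurrence and recurse.
  parity-null : ∀ xs → (∀ a → coeffOf xs a ≡ false) → ∀ h → parity h xs ≡ false
  parity-null xs = go (L.length xs) xs NP.≤-refl
    where
    go : ∀ k xs → L.length xs ≤ k → (∀ a → coeffOf xs a ≡ false) → ∀ h → parity h xs ≡ false
    go _       L.[]       _         _    _ = refl
    go (suc k) (a L.∷ xs) (s≤s len) null h with extract xs (coeff-∈ xs a second-copy)
      where
      second-copy : coeffOf xs a ≡ true
      second-copy = sym (xor-cancel true _ (trans (cong (_xor coeffOf xs a) (sym (does-refl a))) (null a)))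
    ... | ys , len≡ , split = begin
      h a xor parity h xs            ≡⟨ cong (h a xor_) (split h) ⟩
      h a xor (h a xor parity h ys)  ≡⟨ xor-absorb (h a) _ ⟩
      parity h ys                    ≡⟨ go k ys (NP.≤-trans (NP.n≤1+n _) (subst (_≤ k) len≡ len)) ys-null h ⟩
      false                          ∎
      where
      open ≡-Reasoning
      ys-null : ∀ b → coeffOf ys b ≡ false
      ys-null b = trans (sym (xor-absorb (does (a ≟ b)) (coeffOf ys b)))
                        (trans (cong (does (a ≟ b) xor_) (sym (split (λ x → does (x ≟ b))))) (null b))

  parity-coeff-ext : ∀ xs ys → (∀ a → coeffOf xs a ≡ coeffOf ys a) → ∀ h → parity h xs ≡ parity h ys
  parity-coeff-ext xs ys e h = xor-cancel _ _ (trans (sym (parity-++ h xs ys)) (parity-null (xs ++ ys) null h))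
    where
    null : ∀ a → coeffOf (xs ++ ys) a ≡ false
    null a = trans (coeff-++ xs ys a) (trans (cong (_xor coeffOf ys a) (e a)) (xor-same (coeffOf ys a)))

  parity-filter : ∀ (h : A → Bool) xs → parity h (L.filterᵇ h xs) ≡ parity h xs
  parity-filter h L.[] = refl
  parity-filter h (x L.∷ xs) with h x in hx
  ... | true rewrite hx = cong not (parity-filter h xs)
  ... | false = parity-filter h xs

  coeff-filter : ∀ (h : A → Bool) xs a → coeffOf (L.filterᵇ h xs) a ≡ h a ∧ coeffOf xs a
  coeff-filter h L.[] a = sym (∧-zeroʳ (h a))
  coeff-filter h (x L.∷ xs) a with h x in hx | x ≟ a
  ... | true  | yes refl rewrite does-refl x | coeff-filter h xs x | hx = refl
  ... | true  | no x≢a   rewrite does-≢ x≢a = coeff-filter h xs a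
  ... | false | yes refl rewrite coeff-filter h xs x | hx = refl
  ... | false | no _     = coeff-filter h xs a

  parity-coeff-ext-on : ∀ (h : A → Bool) xs ys → (∀ a → h a ≡ true → coeffOf xs a ≡ coeffOf ys a) →
    parity h xs ≡ parity h ys
  parity-coeff-ext-on h xs ys e = begin
    parity h xs                 ≡⟨ sym (parity-filter h xs) ⟩
    parity h (L.filterᵇ h xs)   ≡⟨ parity-coeff-ext (L.filterᵇ h xs) (L.filterᵇ h ys) agree h ⟩
    parity h (L.filterᵇ h ys)   ≡⟨ parity-filter h ys ⟩
    parity h ys                 ∎
    where
    open ≡-Reasoning
    agree : ∀ a → coeffOf (L.filterᵇ h xs) a ≡ coeffOf (L.filterᵇ h ys) a
    agree a with h a in ha
    ... | true  = trans (coeff-filter h xs a) (trans (cong (_∧ coeffOf xs a) ha)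
                    (trans (e a ha) (sym (trans (coeff-filter h ys a) (cong (_∧ coeffOf ys a) ha)))))
    ... | false = trans (coeff-filter h xs a) (trans (cong (_∧ coeffOf xs a) ha)
                    (sym (trans (coeff-filter h ys a) (cong (_∧ coeffOf ys a) ha))))

  parity-concentrated : ∀ (h : A → Bool) xs m → (∀ a → h a ≡ true → a ≢ m → coeffOf xs a ≡ false) →
    parity h xs ≡ h m ∧ coeffOf xs m
  parity-concentrated h xs m off with coeffOf xs m in cm
  ... | true  = trans (parity-coeff-ext-on h xs (m L.∷ L.[]) agree)
                      (trans (xor-identityʳ (h m)) (sym (∧-identityʳ (h m))))
    where
    agree : ∀ a → h a ≡ true → coeffOf xs a ≡ coeffOf (m L.∷ L.[]) a
    agree a ha with m ≟ a
    ... | yes refl = cm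
    ... | no m≢a   = off a ha (λ a≡m → m≢a (sym a≡m))
  ... | false = trans (parity-coeff-ext-on h xs L.[] agree) (sym (∧-zeroʳ (h m)))
    where
    agree : ∀ a → h a ≡ true → coeffOf xs a ≡ false
    agree a ha with a ≟ m
    ... | yes refl = cm
    ... | no a≢m   = off a ha a≢m

parityFin : ∀ {N} → (Fin N → Bool) → Bool
parityFin {zero}  f = false
parityFin {suc N} f = f F.zero xor parityFin (λ t → f (F.suc t))

parityFin-zero : ∀ {N} (f : Fin N → Bool) → (∀ t → f t ≡ false) → parityFin f ≡ false
parityFin-zero {zero}  f _ = refl
parityFin-zero {suc N} f z = cong₂ _xor_ (z F.zero) (parityFin-zero (λ t → f (F.suc t)) (λ t → z (F.suc t)))

parityFin-single : ∀ {N} (f : Fin N → Bool) t₀ → (∀ t → t ≢ t₀ → f t ≡ false) → parityFin f ≡ f t₀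
parityFin-single {suc N} f F.zero z =
  trans (cong (f F.zero xor_) (parityFin-zero (λ t → f (F.suc t)) (λ t → z (F.suc t) (λ ())))) (xor-identityʳ _)
parityFin-single {suc N} f (F.suc t₀) z =
  cong₂ _xor_ (z F.zero (λ ()))
    (parityFin-single (λ t → f (F.suc t)) t₀ (λ t t≢t₀ → z (F.suc t) (λ e → t≢t₀ (FP.suc-injective e))))

parityFin-true : ∀ {N} (f : Fin N → Bool) → parityFin f ≡ true → Σ (Fin N) λ t → f t ≡ true
parityFin-true {suc N} f e with f F.zero in f0
... | true  = F.zero , f0
... | false with parityFin-true (λ t → f (F.suc t)) e
...   | t , ft = F.suc t , ft

Enum : Set → Set
Enum A = Σ (List A) λ xs → Unique xs × (∀ a → a ∈ xs)

enumFin : ∀ n → Enum (Fin n)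
enumFin n = L.allFin n , UniqueP.allFin⁺ n , MemP.∈-allFin

enumMaybe : ∀ {A : Set} → Enum A → Enum (Maybe A)
enumMaybe (xs , uniq , all) =
  nothing L.∷ map just xs ,
  AllP.map⁺ (All.universal (λ _ ()) xs) ∷ᵃ UniqueP.map⁺ just-injective uniq ,
  λ { nothing → here refl ; (just a) → there (MemP.∈-map⁺ just (all a)) }
  where
  just-injective : ∀ {A : Set} {x y : A} → just x ≡ just y → x ≡ y
  just-injective refl = refl

enumVec : ∀ {A : Set} → Enum A → ∀ m → Enum (Vec A m)
enumVec e zero = [] L.∷ L.[] , All.[] ∷ᵃ []ᵃ , λ { [] → here refl }
enumVec e@(xs , uniq , all) (suc m) with enumVec e m
... | ys , uniq′ , all′ =
  L.cartesianProductWith _∷_ xs ys ,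
  UniqueP.cartesianProductWith⁺ _∷_ VP.∷-injective uniq uniq′ ,
  λ { (x ∷ v) → MemP.∈-cartesianProductWith⁺ _∷_ (all x) (all′ v) }

lookup-fromList : ∀ {A : Set} (xs : List A) i → lookup (V.fromList xs) i ≡ L.lookup xs i
lookup-fromList (x L.∷ xs) F.zero    = refl
lookup-fromList (x L.∷ xs) (F.suc i) = lookup-fromList xs i

lookup-injective : ∀ {A : Set} (xs : List A) → Unique xs → ∀ i j → L.lookup xs i ≡ L.lookup xs j → i ≡ j
lookup-injective (x L.∷ xs) (_ ∷ᵃ _)    F.zero    F.zero    _ = refl
lookup-injective (x L.∷ xs) (x∉ ∷ᵃ _)   F.zero    (F.suc j) e = ⊥-elim (All.lookup x∉ (MemP.∈-lookup j) e)
lookup-injective (x L.∷ xs) (x∉ ∷ᵃ _)   (F.suc i) F.zero    e = ⊥-elim (All.lookup x∉ (MemP.∈-lookup i) (sym e))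
lookup-injective (x L.∷ xs) (_ ∷ᵃ uniq) (F.suc i) (F.suc j) e = cong F.suc (lookup-injective xs uniq i j e)

card-of-list : ∀ {A : Set} {P : A → Set} (xs : List A) → Unique xs →
  (∀ x → x ∈ xs → P x) → (∀ a → P a → a ∈ xs) → Card P (L.length xs)
card-of-list {P = P} xs uniq sound complete =
  V.fromList xs ,
  (λ i → subst P (sym (lookup-fromList xs i)) (sound _ (MemP.∈-lookup i))) ,
  (λ i j e → lookup-injective xs uniq i j (trans (sym (lookup-fromList xs i)) (trans e (lookup-fromList xs j)))) ,
  (λ a pa → Any.index (complete a pa) ,
            trans (lookup-fromList xs _) (sym (AnyP.lookup-index (complete a pa))))

count : ∀ {A : Set} {P : A → Set} → Enum A → (∀ a → Dec (P a)) → Σ ℕ (Card P)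
count (xs , uniq , all) P? =
  L.length (L.filter P? xs) ,
  card-of-list (L.filter P? xs) (UniqueP.filter⁺ P? uniq)
    (λ x x∈ → proj₂ (MemP.∈-filter⁻ P? {xs = xs} x∈)) (λ a pa → MemP.∈-filter⁺ P? (all a) pa)

card-bijection : ∀ {A B : Set} {P : A → Set} {Q : B → Set} {N} (f : A → B) → Card P N →
  (∀ a → P a → Q (f a)) → (∀ a a′ → P a → P a′ → f a ≡ f a′ → a ≡ a′) →
  (∀ b → Q b → Σ A λ a → P a × f a ≡ b) → Card Q N
card-bijection {Q = Q} f (v , inP , injective , complete) maps f-inj f-onto =
  V.map f v ,
  (λ i → subst Q (sym (VP.lookup-map i f v)) (maps _ (inP i))) ,
  (λ i j e → injective i j (f-inj _ _ (inP i) (inP j)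
               (trans (sym (VP.lookup-map i f v)) (trans e (VP.lookup-map j f v))))) ,
  (λ b qb → let (a , pa , fa≡b) = f-onto b qb ; (i , vi≡a) = complete a pa
            in i , trans (VP.lookup-map i f v) (trans (cong f vi≡a) fa≡b))

unique-by-order : ∀ {m} (P : Fin m → Set) → (∀ {x y} → x F.< y → P x → P y → ⊥) →
  ∀ {x y} → P x → P y → x ≡ y
unique-by-order P no-pair {x} {y} px py with FP.<-cmp x y
... | tri< x<y _ _ = ⊥-elim (no-pair x<y px py)
... | tri≈ _ x≡y _ = x≡y
... | tri> _ _ y<x = ⊥-elim (no-pair y<x py px)

<⇒≢ : ∀ {m} {x y : Fin m} → x F.< y → x ≢ y
<⇒≢ x<y refl = NP.<-irrefl refl x<y

module Arrays (r s n : ℕ) where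

  Arr : Set → Set
  Arr A = Vec (Vec (Vec A n) s) r

  Mn : Set
  Mn = Mon r s n

  Pt : Set
  Pt = Point {r} {s} {n}

  at : {A : Set} → Arr A → Fin r → Fin s → Fin n → A
  at x i j k = lookup (lookup (lookup x i) j) k

  array-ext : {A : Set} {x y : Arr A} → (∀ i j k → at x i j k ≡ at y i j k) → x ≡ y
  array-ext h = vec-ext (λ i → vec-ext (λ j → vec-ext (λ k → h i j k)))

  map3 : {A B : Set} → (A → B) → Arr A → Arr B
  map3 f = V.map (V.map (V.map f))

  at-map3 : ∀ {A B : Set} (f : A → B) (x : Arr A) i j k → at (map3 f x) i j k ≡ f (at x i j k)
  at-map3 f x i j k =
    trans (cong (λ z → lookup (lookup z j) k) (VP.lookup-map i (V.map (V.map f)) x))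
      (trans (cong (λ z → lookup z k) (VP.lookup-map j (V.map f) (lookup x i)))
        (VP.lookup-map k f (lookup (lookup x i) j)))

  zip3 : {A B C : Set} → (A → B → C) → Arr A → Arr B → Arr C
  zip3 f = zipWith (zipWith (zipWith f))

  at-zip3 : ∀ {A B C : Set} (f : A → B → C) x y i j k → at (zip3 f x y) i j k ≡ f (at x i j k) (at y i j k)
  at-zip3 f x y i j k =
    trans (cong (λ z → lookup (lookup z j) k) (VP.lookup-zipWith (zipWith (zipWith f)) i x y))
      (trans (cong (λ z → lookup z k) (VP.lookup-zipWith (zipWith f) j (lookup x i) (lookup y i)))
        (VP.lookup-zipWith f k (lookup (lookup x i) j) (lookup (lookup y i) j)))

  tab3 : {A : Set} → (Fin r → Fin s → Fin n → A) → Arr A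
  tab3 f = tabulate λ i → tabulate λ j → tabulate λ k → f i j k

  at-tab3 : ∀ {A : Set} (f : Fin r → Fin s → Fin n → A) i j k → at (tab3 f) i j k ≡ f i j k
  at-tab3 f i j k =
    trans (cong (λ z → lookup (lookup z j) k) (VP.lookup∘tabulate (λ i → tabulate λ j → tabulate λ k → f i j k) i))
      (trans (cong (λ z → lookup z k) (VP.lookup∘tabulate (λ j → tabulate λ k → f i j k) j))
        (VP.lookup∘tabulate (λ k → f i j k) k))

  at-mul : (μ ν : Mn) → ∀ i j k → at (μ *ₘ ν) i j k ≡ at μ i j k + at ν i j k
  at-mul = at-zip3 _+_

  one : Mn
  one = tab3 (λ _ _ _ → 0)

  one-*ₘ : ∀ μ → one *ₘ μ ≡ μ
  one-*ₘ μ = array-ext (λ i j k → trans (at-mul one μ i j k) (cong (_+ at μ i j k) (at-tab3 _ i j k)))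

  SameCell : Fin r → Fin s → Fin n → Fin r → Fin s → Fin n → Set
  SameCell i j k i′ j′ k′ = i ≡ i′ × j ≡ j′ × k ≡ k′

  sameCell? : ∀ i j k i′ j′ k′ → Dec (SameCell i j k i′ j′ k′)
  sameCell? i j k i′ j′ k′ = (i F.≟ i′) ×-dec (j F.≟ j′) ×-dec (k F.≟ k′)

  at-var : ∀ i j k i′ j′ k′ → at (var {r} {s} {n} i j k) i′ j′ k′ ≡
    (if does (i F.≟ i′) ∧ does (j F.≟ j′) ∧ does (k F.≟ k′) then 1 else 0)
  at-var i j k i′ j′ k′ = at-tab3 _ i′ j′ k′

  var-same : ∀ i j k → at (var {r} {s} {n} i j k) i j k ≡ 1
  var-same i j k rewrite at-var i j k i j k with i F.≟ i | j F.≟ j | k F.≟ k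
  ... | yes _ | yes _ | yes _ = refl
  ... | no i≢i | _     | _     = ⊥-elim (i≢i refl)
  ... | yes _ | no j≢j | _     = ⊥-elim (j≢j refl)
  ... | yes _ | yes _ | no k≢k = ⊥-elim (k≢k refl)

  var-other : ∀ i j k i′ j′ k′ → ¬ SameCell i j k i′ j′ k′ → at (var {r} {s} {n} i j k) i′ j′ k′ ≡ 0
  var-other i j k i′ j′ k′ diff rewrite at-var i j k i′ j′ k′ with i F.≟ i′ | j F.≟ j′ | k F.≟ k′
  ... | yes i≡ | yes j≡ | yes k≡ = ⊥-elim (diff (i≡ , j≡ , k≡))
  ... | no _   | _      | _      = refl
  ... | yes _  | no _   | _      = refl
  ... | yes _  | yes _  | no _   = refl

  -- Divisibility of monomials is entrywise ≤ of exponents, and the quotient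
  -- is entrywise truncated subtraction.
  _∣ₘ_ : Mn → Mn → Set
  μ ∣ₘ ν = ∀ i j k → at μ i j k ≤ at ν i j k

  _/ₘ_ : Mn → Mn → Mn
  _/ₘ_ = zip3 _∸_

  ∣ₘ-quotient : ∀ {d μ} → d ∣ₘ μ → μ ≡ (μ /ₘ d) *ₘ d
  ∣ₘ-quotient {d} {μ} d∣μ = array-ext λ i j k → sym (begin
    at ((μ /ₘ d) *ₘ d) i j k          ≡⟨ at-mul (μ /ₘ d) d i j k ⟩
    at (μ /ₘ d) i j k + at d i j k    ≡⟨ cong (_+ at d i j k) (at-zip3 _∸_ μ d i j k) ⟩
    at μ i j k ∸ at d i j k + at d i j k ≡⟨ NP.m∸n+n≡m (d∣μ i j k) ⟩
    at μ i j k                        ∎)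
    where open ≡-Reasoning

  ∣ₘ-*ₘ : ∀ q d → d ∣ₘ (q *ₘ d)
  ∣ₘ-*ₘ q d i j k = subst (at d i j k ≤_) (sym (at-mul q d i j k)) (NP.m≤n+m _ _)

module Evaluation (r s n : ℕ) where
  open Arrays r s n

  +≢0 : ∀ x y → x + y ≢ 0 → x ≢ 0 ⊎ y ≢ 0
  +≢0 zero    y x+y≢0 = inj₂ x+y≢0
  +≢0 (suc x) y _     = inj₁ (λ ())

  private
    power : Bool → ℕ → Bool
    power = pw {r} {s} {n}

    power-true : ∀ b e → power b e ≡ true → e ≢ 0 → b ≡ true
    power-true b zero    _ e≢0 = ⊥-elim (e≢0 refl)
    power-true b (suc e) p _   = p

    power-intro : ∀ b e → (e ≢ 0 → b ≡ true) → power b e ≡ true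
    power-intro b zero    _ = refl
    power-intro b (suc e) f = f (λ ())

  evalMon-true : (a : Pt) (μ : Mn) → evalMon a μ ≡ true → ∀ i j k → at μ i j k ≢ 0 → at a i j k ≡ true
  evalMon-true a μ e i j k = power-true _ _
    (conj-true power (lookup (lookup a i) j) (lookup (lookup μ i) j)
      (conj-true (λ ac μc → conj (zipWith power ac μc)) (lookup a i) (lookup μ i)
        (conj-true (λ ar μr → conj (zipWith (λ ac μc → conj (zipWith power ac μc)) ar μr)) a μ e i) j) k)

  evalMon-intro : (a : Pt) (μ : Mn) → (∀ i j k → at μ i j k ≢ 0 → at a i j k ≡ true) → evalMon a μ ≡ true
  evalMon-intro a μ h =
    conj-intro (λ ar μr → conj (zipWith (λ ac μc → conj (zipWith power ac μc)) ar μr)) a μ λ i →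
      conj-intro (λ ac μc → conj (zipWith power ac μc)) (lookup a i) (lookup μ i) λ j →
        conj-intro power (lookup (lookup a i) j) (lookup (lookup μ i) j) λ k →
          power-intro _ _ (h i j k)

  evalMon-mul : (a : Pt) (μ ν : Mn) → evalMon a (μ *ₘ ν) ≡ evalMon a μ ∧ evalMon a ν
  evalMon-mul a μ ν = bool-ext
    (λ e → cong₂ _∧_
      (evalMon-intro a μ λ i j k μ≢0 → evalMon-true a (μ *ₘ ν) e i j k
         (λ z → μ≢0 (NP.m+n≡0⇒m≡0 (at μ i j k) (trans (sym (at-mul μ ν i j k)) z))))
      (evalMon-intro a ν λ i j k ν≢0 → evalMon-true a (μ *ₘ ν) e i j k
         (λ z → ν≢0 (NP.m+n≡0⇒n≡0 (at μ i j k) (trans (sym (at-mul μ ν i j k)) z)))))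
    (λ e → evalMon-intro a (μ *ₘ ν) λ i j k μν≢0 →
      [ evalMon-true a μ (∧-conicalˡ _ _ e) i j k , evalMon-true a ν (∧-conicalʳ (evalMon a μ) _ e) i j k ]′
        (+≢0 (at μ i j k) (at ν i j k) (λ z → μν≢0 (trans (at-mul μ ν i j k) z))))

  evalMon-var : (a : Pt) → ∀ i j k → evalMon a (var i j k) ≡ at a i j k
  evalMon-var a i j k = bool-ext
    (λ e → evalMon-true a (var i j k) e i j k (λ z → 1≢0 (trans (sym (var-same i j k)) z)))
    (λ aijk → evalMon-intro a (var i j k) λ i′ j′ k′ ≢0 → only-cell i′ j′ k′ aijk ≢0)
    where
    1≢0 : 1 ≢ 0
    1≢0 ()
    only-cell : ∀ i′ j′ k′ → at a i j k ≡ true → at (var i j k) i′ j′ k′ ≢ 0 → at a i′ j′ k′ ≡ true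
    only-cell i′ j′ k′ aijk ≢0 with sameCell? i j k i′ j′ k′
    ... | yes (refl , refl , refl) = aijk
    ... | no diff = ⊥-elim (≢0 (var-other i j k i′ j′ k′ diff))

  eval-++ : ∀ (a : Pt) p q → eval a (p ++ q) ≡ eval a p xor eval a q
  eval-++ a = parity-++ (evalMon a)

  eval-mul : ∀ (a : Pt) p q → eval a (p *ₚ q) ≡ eval a p ∧ eval a q
  eval-mul a p q = begin
    eval a (p *ₚ q)                                          ≡⟨ parity-concatMap (evalMon a) (λ μ → map (μ *ₘ_) q) p ⟩
    parity (λ μ → parity (evalMon a) (map (μ *ₘ_) q)) p      ≡⟨ parity-cong _ _ p term ⟩
    parity (λ μ → evalMon a μ ∧ eval a q) p                  ≡⟨ parity-∧ʳ (evalMon a) (eval a q) p ⟩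
    eval a p ∧ eval a q                                      ∎
    where
    open ≡-Reasoning
    term : ∀ μ → parity (evalMon a) (map (μ *ₘ_) q) ≡ evalMon a μ ∧ eval a q
    term μ = trans (parity-map (evalMon a) (μ *ₘ_) q)
               (trans (parity-cong _ _ q (evalMon-mul a μ)) (parity-∧ˡ (evalMon a) (evalMon a μ) q))

module Ideals (r s n : ℕ) where
  open Arrays r s n

  Pl : Set
  Pl = Poly r s n

  Ideal : Pl → Set
  Ideal p = p ∈⟨ IGens r s n ⟩

  open Coefficients (_≟ₘ_ {r} {s} {n}) public

  term : Pl × Σ Pl (IGens r s n) → Pl
  term (q , g , _) = q *ₚ g

  combination : List (Pl × Σ Pl (IGens r s n)) → Pl
  combination cs = sumₚ (map term cs)

  coeff≡coeffOf : ∀ (p : Pl) μ → coeff p μ ≡ coeffOf p μ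
  coeff≡coeffOf L.[]       μ = refl
  coeff≡coeffOf (ν L.∷ p) μ with does (ν ≟ₘ μ)
  ... | true  = cong not (coeff≡coeffOf p μ)
  ... | false = coeff≡coeffOf p μ

  ≈ₚ⇒parity : ∀ {p q : Pl} → p ≈ₚ q → ∀ h → parity h p ≡ parity h q
  ≈ₚ⇒parity {p} {q} e = parity-coeff-ext p q (λ μ → trans (sym (coeff≡coeffOf p μ)) (trans (e μ) (coeff≡coeffOf q μ)))

  ideal-resp : ∀ {p q : Pl} → (∀ μ → coeffOf p μ ≡ coeffOf q μ) → Ideal q → Ideal p
  ideal-resp {p} {q} e (cs , q≈) = cs , λ μ →
    trans (coeff≡coeffOf p μ) (trans (e μ) (trans (sym (coeff≡coeffOf q μ)) (q≈ μ)))

  ideal-zero : Ideal L.[]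
  ideal-zero = L.[] , λ _ → refl

  ideal-++ : ∀ {p q : Pl} → Ideal p → Ideal q → Ideal (p ++ q)
  ideal-++ {p} {q} (cs , p≈) (cs′ , q≈) = cs ++ cs′ , λ μ → begin
    coeff (p ++ q) μ                              ≡⟨ coeff≡coeffOf (p ++ q) μ ⟩
    coeffOf (p ++ q) μ                            ≡⟨ coeff-++ p q μ ⟩
    coeffOf p μ xor coeffOf q μ                   ≡⟨ cong₂ _xor_ (trans (sym (coeff≡coeffOf p μ)) (p≈ μ))
                                                                 (trans (sym (coeff≡coeffOf q μ)) (q≈ μ)) ⟩
    coeff (∑ cs) μ xor coeff (∑ cs′) μ            ≡⟨ cong₂ _xor_ (coeff≡coeffOf (∑ cs) μ) (coeff≡coeffOf (∑ cs′) μ) ⟩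
    coeffOf (∑ cs) μ xor coeffOf (∑ cs′) μ        ≡⟨ sym (coeff-++ (∑ cs) (∑ cs′) μ) ⟩
    coeffOf (∑ cs ++ ∑ cs′) μ                     ≡⟨ sym (coeff≡coeffOf (∑ cs ++ ∑ cs′) μ) ⟩
    coeff (∑ cs ++ ∑ cs′) μ                       ≡⟨ cong (λ z → coeff z μ) (sym (sum-++ cs cs′)) ⟩
    coeff (∑ (cs ++ cs′)) μ                       ∎
    where
    open ≡-Reasoning
    ∑ = combination
    sum-++ : ∀ cs cs′ → ∑ (cs ++ cs′) ≡ ∑ cs ++ ∑ cs′
    sum-++ L.[]       cs′ = refl
    sum-++ (c L.∷ cs) cs′ = trans (cong (term c ++_) (sum-++ cs cs′)) (sym (LP.++-assoc (term c) _ _))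

  ideal-multiple : ∀ (q : Pl) (g : Gen r s n) → Ideal (q *ₚ gen g)
  ideal-multiple q g = (q , gen g , g , refl) L.∷ L.[] , λ μ → cong (λ z → coeff z μ) (sym (LP.++-identityʳ (q *ₚ gen g)))

  ideal-gen : ∀ (g : Gen r s n) → Ideal (gen g)
  ideal-gen g = subst Ideal (one-*ₚ (gen g)) (ideal-multiple (one L.∷ L.[]) g)
    where
    one-*ₚ : ∀ (p : Pl) → (one L.∷ L.[]) *ₚ p ≡ p
    one-*ₚ p = trans (LP.++-identityʳ (map (one *ₘ_) p)) (trans (LP.map-cong one-*ₘ p) (LP.map-id p))

module Variety (r s n : ℕ) where
  open Arrays r s n
  open Evaluation r s n
  open Ideals r s n

  SymbolConflict RowConflict ColumnConflict Conflict ConflictFree : Pt → Set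
  SymbolConflict a = ∃ λ i → ∃ λ j → ∃ λ k → ∃ λ k′ → k F.< k′ × at a i j k ≡ true × at a i j k′ ≡ true
  RowConflict    a = ∃ λ i → ∃ λ j → ∃ λ j′ → ∃ λ k → j F.< j′ × at a i j k ≡ true × at a i j′ k ≡ true
  ColumnConflict a = ∃ λ i → ∃ λ i′ → ∃ λ j → ∃ λ k → i F.< i′ × at a i j k ≡ true × at a i′ j k ≡ true
  Conflict       a = SymbolConflict a ⊎ RowConflict a ⊎ ColumnConflict a
  ConflictFree   a = ¬ Conflict a

  conflict? : ∀ a → Dec (Conflict a)
  conflict? a =
    FP.any? (λ i → FP.any? (λ j → FP.any? (λ k → FP.any? (λ k′ →
      (k FP.<? k′) ×-dec (at a i j k BP.≟ true) ×-dec (at a i j k′ BP.≟ true)))))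
    ⊎-dec FP.any? (λ i → FP.any? (λ j → FP.any? (λ j′ → FP.any? (λ k →
      (j FP.<? j′) ×-dec (at a i j k BP.≟ true) ×-dec (at a i j′ k BP.≟ true)))))
    ⊎-dec FP.any? (λ i → FP.any? (λ i′ → FP.any? (λ j → FP.any? (λ k →
      (i FP.<? i′) ×-dec (at a i j k BP.≟ true) ×-dec (at a i′ j k BP.≟ true)))))

  conflictGen : ∀ a → Conflict a → Gen r s n
  conflictGen a (inj₁ (i , j , k , k′ , k<k′ , _))               = gsym i j k k′ k<k′
  conflictGen a (inj₂ (inj₁ (i , j , j′ , k , j<j′ , _)))        = grow i j j′ k j<j′
  conflictGen a (inj₂ (inj₂ (i , i′ , j , k , i<i′ , _)))        = gcol i i′ j k i<i′

  conflictMono : ∀ a → Conflict a → Mn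
  conflictMono a (inj₁ (i , j , k , k′ , _))        = var i j k *ₘ var i j k′
  conflictMono a (inj₂ (inj₁ (i , j , j′ , k , _))) = var i j k *ₘ var i j′ k
  conflictMono a (inj₂ (inj₂ (i , i′ , j , k , _))) = var i j k *ₘ var i′ j k

  gen-conflictGen : ∀ a c → gen (conflictGen a c) ≡ conflictMono a c L.∷ L.[]
  gen-conflictGen a (inj₁ _)        = refl
  gen-conflictGen a (inj₂ (inj₁ _)) = refl
  gen-conflictGen a (inj₂ (inj₂ _)) = refl

  eval-varProduct : ∀ (a : Pt) i j k i′ j′ k′ →
    eval a ((var i j k *ₘ var i′ j′ k′) L.∷ L.[]) ≡ at a i j k ∧ at a i′ j′ k′
  eval-varProduct a i j k i′ j′ k′ =
    trans (xor-identityʳ _) (trans (evalMon-mul a _ _) (cong₂ _∧_ (evalMon-var a i j k) (evalMon-var a i′ j′ k′)))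

  gen-vanishes : (a : Pt) → ConflictFree a → ∀ g → eval a (gen g) ≡ false
  gen-vanishes a cf (gsq i j k) = begin
    evalMon a (x *ₘ x) xor (evalMon a x xor false) ≡⟨ cong₂ _xor_ (evalMon-mul a x x) (xor-identityʳ _) ⟩
    (evalMon a x ∧ evalMon a x) xor evalMon a x    ≡⟨ cong (_xor evalMon a x) (∧-idem (evalMon a x)) ⟩
    evalMon a x xor evalMon a x                    ≡⟨ xor-same (evalMon a x) ⟩
    false                                          ∎
    where open ≡-Reasoning
          x = var i j k
  gen-vanishes a cf (gcol i i′ j k i<i′) = trans (eval-varProduct a i j k i′ j k)
    (∧-false (λ p q → cf (inj₂ (inj₂ (i , i′ , j , k , i<i′ , p , q)))))
  gen-vanishes a cf (grow i j j′ k j<j′) = trans (eval-varProduct a i j k i j′ k)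
    (∧-false (λ p q → cf (inj₂ (inj₁ (i , j , j′ , k , j<j′ , p , q)))))
  gen-vanishes a cf (gsym i j k k′ k<k′) = trans (eval-varProduct a i j k i j k′)
    (∧-false (λ p q → cf (inj₁ (i , j , k , k′ , k<k′ , p , q))))

  ideal-vanishes : (a : Pt) → ConflictFree a → ∀ p → Ideal p → eval a p ≡ false
  ideal-vanishes a cf p (cs , p≈) = trans (≈ₚ⇒parity {p} {combination cs} p≈ (evalMon a)) (sum-vanishes cs)
    where
    sum-vanishes : ∀ cs → eval a (combination cs) ≡ false
    sum-vanishes L.[] = refl
    sum-vanishes ((q , g , g′ , refl) L.∷ cs) = trans (eval-++ a (q *ₚ gen g′) _)
      (cong₂ _xor_ (trans (eval-mul a q (gen g′)) (trans (cong (eval a q ∧_) (gen-vanishes a cf g′)) (∧-zeroʳ (eval a q))))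
                   (sum-vanishes cs))

  conflictGen-nonzero : (a : Pt) (c : Conflict a) → eval a (gen (conflictGen a c)) ≡ true
  conflictGen-nonzero a (inj₁ (i , j , k , k′ , _ , p , q))        = trans (eval-varProduct a i j k i j k′) (cong₂ _∧_ p q)
  conflictGen-nonzero a (inj₂ (inj₁ (i , j , j′ , k , _ , p , q))) = trans (eval-varProduct a i j k i j′ k) (cong₂ _∧_ p q)
  conflictGen-nonzero a (inj₂ (inj₂ (i , i′ , j , k , _ , p , q))) = trans (eval-varProduct a i j k i′ j k) (cong₂ _∧_ p q)

  zero⇒conflictFree : (a : Pt) → InV (IGens r s n) a → ConflictFree a
  zero⇒conflictFree a a∈V c =
    true≢false (trans (sym (conflictGen-nonzero a c)) (a∈V (gen (conflictGen a c)) (ideal-gen (conflictGen a c))))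

  Rc : Set
  Rc = Rect r s n

  isK′ : Maybe (Fin n) → Fin n → Bool
  isK′ = isK {r} {s} {n}

  at-toPoint : (P : Rc) → ∀ i j k → at (toPoint P) i j k ≡ isK′ (entry P i j) k
  at-toPoint P = at-tab3 (λ i j k → isK′ (entry P i j) k)

  isK-true : ∀ e k → isK′ e k ≡ true → e ≡ just k
  isK-true (just k′) k p with k′ F.≟ k
  ... | yes refl = refl

  isK-self : ∀ k → isK′ (just k) k ≡ true
  isK-self k with k F.≟ k
  ... | yes _   = refl
  ... | no k≢k = ⊥-elim (k≢k refl)

  isK-injective : ∀ e e′ → (∀ k → isK′ e k ≡ isK′ e′ k) → e ≡ e′
  isK-injective (just k) e′ f = sym (isK-true e′ k (trans (sym (f k)) (isK-self k)))
  isK-injective nothing (just k) f with trans (f k) (isK-self k)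
  ... | ()
  isK-injective nothing nothing _ = refl

  toPoint-injective : (P Q : Rc) → toPoint P ≡ toPoint Q → P ≡ Q
  toPoint-injective P Q e = vec-ext λ i → vec-ext λ j → isK-injective _ _ λ k →
    trans (sym (at-toPoint P i j k)) (trans (cong (λ z → at z i j k) e) (at-toPoint Q i j k))

  entry⇒at : (P : Rc) → ∀ i j k → entry P i j ≡ just k → at (toPoint P) i j k ≡ true
  entry⇒at P i j k e = trans (at-toPoint P i j k) (trans (cong (λ z → isK′ z k) e) (isK-self k))

  at⇒entry : (P : Rc) → ∀ i j k → at (toPoint P) i j k ≡ true → entry P i j ≡ just k
  at⇒entry P i j k p = isK-true (entry P i j) k (trans (sym (at-toPoint P i j k)) p)

  PLR⇒conflictFree : (P : Rc) → IsPLR P → ConflictFree (toPoint P)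
  PLR⇒conflictFree P _ (inj₁ (i , j , k , k′ , k<k′ , p , q)) =
    <⇒≢ k<k′ (just-injective (trans (sym (at⇒entry P i j k p)) (at⇒entry P i j k′ q)))
    where just-injective : ∀ {x y : Fin n} → just x ≡ just y → x ≡ y
          just-injective refl = refl
  PLR⇒conflictFree P (rows , _) (inj₂ (inj₁ (i , j , j′ , k , j<j′ , p , q))) =
    <⇒≢ j<j′ (rows i j j′ k (at⇒entry P i j k p) (at⇒entry P i j′ k q))
  PLR⇒conflictFree P (_ , columns) (inj₂ (inj₂ (i , i′ , j , k , i<i′ , p , q))) =
    <⇒≢ i<i′ (columns i i′ j k (at⇒entry P i j k p) (at⇒entry P i′ j k q))

  conflictFree⇒PLR : (P : Rc) → ConflictFree (toPoint P) → IsPLR P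
  conflictFree⇒PLR P cf =
    (λ i j j′ k → unique-by-order (λ j → entry P i j ≡ just k)
       (λ {j} {j′} j<j′ e e′ → cf (inj₂ (inj₁ (i , j , j′ , k , j<j′ , entry⇒at P i j k e , entry⇒at P i j′ k e′))))) ,
    (λ i i′ j k → unique-by-order (λ i → entry P i j ≡ just k)
       (λ {i} {i′} i<i′ e e′ → cf (inj₂ (inj₂ (i , i′ , j , k , i<i′ , entry⇒at P i j k e , entry⇒at P i′ j k e′)))))

  isPLR? : ∀ P → Dec (IsPLR P)
  isPLR? P with conflict? (toPoint P)
  ... | yes c  = no (λ plr → PLR⇒conflictFree P plr c)
  ... | no cf  = yes (conflictFree⇒PLR P cf)

  symbolAt : Vec Bool n → Maybe (Fin n)
  symbolAt v with FP.any? (λ k → lookup v k BP.≟ true)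
  ... | yes (k , _) = just k
  ... | no _        = nothing

  isK-symbolAt : ∀ (v : Vec Bool n) → (∀ {k k′} → lookup v k ≡ true → lookup v k′ ≡ true → k ≡ k′) →
    ∀ k → isK′ (symbolAt v) k ≡ lookup v k
  isK-symbolAt v unique k with FP.any? (λ k → lookup v k BP.≟ true)
  ... | yes (k₀ , v₀) with k₀ F.≟ k
  ...   | yes refl = sym v₀
  ...   | no k₀≢k with lookup v k in vk
  ...     | false = refl
  ...     | true  = ⊥-elim (k₀≢k (unique v₀ vk))
  isK-symbolAt v unique k | no none with lookup v k in vk
  ... | false = refl
  ... | true  = ⊥-elim (none (k , vk))

  fromPoint : Pt → Rc
  fromPoint = V.map (V.map symbolAt)

  toPoint-fromPoint : (a : Pt) → ConflictFree a → toPoint (fromPoint a) ≡ a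
  toPoint-fromPoint a cf = array-ext λ i j k → begin
    at (toPoint (fromPoint a)) i j k        ≡⟨ at-toPoint (fromPoint a) i j k ⟩
    isK′ (entry (fromPoint a) i j) k        ≡⟨ cong (λ z → isK′ z k) entry-fromPoint ⟩
    isK′ (symbolAt (lookup (lookup a i) j)) k ≡⟨ isK-symbolAt _ (unique-by-order (λ k → at a i j k ≡ true)
                                                   (λ {k} {k′} k<k′ p q → cf (inj₁ (i , j , k , k′ , k<k′ , p , q)))) k ⟩
    at a i j k                              ∎
    where
    open ≡-Reasoning
    entry-fromPoint : ∀ {i j} → entry (fromPoint a) i j ≡ symbolAt (lookup (lookup a i) j)
    entry-fromPoint {i} {j} =
      trans (cong (λ z → lookup z j) (VP.lookup-map i (V.map symbolAt) a)) (VP.lookup-map j symbolAt (lookup a i))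

  fromPoint-PLR : (a : Pt) → ConflictFree a → IsPLR (fromPoint a)
  fromPoint-PLR a cf = conflictFree⇒PLR (fromPoint a) (subst ConflictFree (sym (toPoint-fromPoint a cf)) cf)

  plr-zero : (P : Rc) → IsPLR P → InV (IGens r s n) (toPoint P)
  plr-zero P plr f f∈I = ideal-vanishes (toPoint P) (PLR⇒conflictFree P plr) f f∈I

  zero-plr : (a : Pt) → InV (IGens r s n) a → Σ Rc λ P → IsPLR P × toPoint P ≡ a
  zero-plr a a∈V = fromPoint a , fromPoint-PLR a cf , toPoint-fromPoint a cf
    where cf = zero⇒conflictFree a a∈V

module Degrees (r s n : ℕ) where
  open Arrays r s n

  cellDeg : Vec ℕ n → ℕ
  cellDeg w = V.sum (V.map (λ e → e) w)

  rowDeg : ∀ {m} → Vec (Vec ℕ n) m → ℕ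
  rowDeg row = V.sum (V.map cellDeg row)

  total : ∀ {m} → Vec (Vec (Vec ℕ n) s) m → ℕ
  total μ = V.sum (V.map rowDeg μ)

  flatRows : ∀ {m} → Vec (Vec (Vec ℕ n) s) m → List ℕ
  flatRows μ = L.concat (L.concat (V.toList (V.map (λ row → V.toList (V.map V.toList row)) μ)))

  flatRow : ∀ {m} → Vec (Vec ℕ n) m → List ℕ
  flatRow row = L.concat (V.toList (V.map V.toList row))

  flatRows-∷ : ∀ {m} row (μ : Vec (Vec (Vec ℕ n) s) m) → flatRows (row ∷ μ) ≡ flatRow row ++ flatRows μ
  flatRows-∷ row μ = sym (LP.concat-++ (V.toList (V.map V.toList row)) _)

  deg≡total : (μ : Mn) → deg μ ≡ total μ
  deg≡total = rows
    where
    cell : ∀ {m} (w : Vec ℕ m) → LA.sum (V.toList w) ≡ V.sum (V.map (λ e → e) w)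
    cell []      = refl
    cell (e ∷ w) = cong (e +_) (cell w)
    row : ∀ {m} (v : Vec (Vec ℕ n) m) → LA.sum (flatRow v) ≡ rowDeg v
    row []      = refl
    row (w ∷ v) = trans (LAP.sum-++ (V.toList w) _) (cong₂ _+_ (cell w) (row v))
    rows : ∀ {m} (μ : Vec (Vec (Vec ℕ n) s) m) → LA.sum (flatRows μ) ≡ total μ
    rows []      = refl
    rows (v ∷ μ) = trans (cong LA.sum (flatRows-∷ v μ))
                     (trans (LAP.sum-++ (flatRow v) _) (cong₂ _+_ (row v) (rows μ)))

  deg-mono : ∀ {μ ν} → μ ∣ₘ ν → deg μ ≤ deg ν
  deg-mono {μ} {ν} μ∣ν = subst₂ _≤_ (sym (deg≡total μ)) (sym (deg≡total ν))
    (sum-map-mono rowDeg rowDeg μ ν λ i → sum-map-mono cellDeg cellDeg (lookup μ i) (lookup ν i) λ j →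
       sum-map-mono (λ e → e) (λ e → e) (lookup (lookup μ i) j) (lookup (lookup ν i) j) (μ∣ν i j))

  ∣ₘ-deg-≡ : ∀ {μ ν} → μ ∣ₘ ν → deg μ ≡ deg ν → μ ≡ ν
  ∣ₘ-deg-≡ {μ} {ν} μ∣ν e = array-ext λ i j →
    sum-map-tight (λ e → e) (λ e → e) (lookup (lookup μ i) j) (lookup (lookup ν i) j) (μ∣ν i j)
      (sum-map-tight cellDeg cellDeg (lookup μ i) (lookup ν i) (row≤ i)
        (sum-map-tight rowDeg rowDeg μ ν (λ i → sum-map-mono cellDeg cellDeg (lookup μ i) (lookup ν i) (row≤ i))
          (trans (sym (deg≡total μ)) (trans e (deg≡total ν))) i) j)
    where
    row≤ : ∀ i j → cellDeg (lookup (lookup μ i) j) ≤ cellDeg (lookup (lookup ν i) j)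
    row≤ i j = sum-map-mono (λ e → e) (λ e → e) (lookup (lookup μ i) j) (lookup (lookup ν i) j) (μ∣ν i j)

  ∣ₘ-deg-< : ∀ {μ ν} → μ ∣ₘ ν → μ ≢ ν → deg μ < deg ν
  ∣ₘ-deg-< {μ} {ν} μ∣ν μ≢ν = NP.≤∧≢⇒< (deg-mono {μ} {ν} μ∣ν) (λ e → μ≢ν (∣ₘ-deg-≡ {μ} {ν} μ∣ν e))

  pointwise⇒lex : ∀ {xs ys} → Pw.Pointwise _≤_ xs ys → xs ≡ ys ⊎ LexLt xs ys
  pointwise⇒lex Pw.[] = inj₁ refl
  pointwise⇒lex (x≤y Pw.∷ xs≤ys) with NP.m≤n⇒m<n∨m≡n x≤y | pointwise⇒lex xs≤ys
  ... | inj₁ x<y  | _           = inj₂ (here x<y)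
  ... | inj₂ refl | inj₁ refl   = inj₁ refl
  ... | inj₂ refl | inj₂ xs<ys  = inj₂ (there xs<ys)

  ∣ₘ⇒lex : ∀ {μ ν} → μ ∣ₘ ν → μ ≡ ν ⊎ μ <ₘ ν
  ∣ₘ⇒lex {μ} {ν} μ∣ν with pointwise⇒lex (rows μ ν (λ i → μ∣ν i))
    where
    cell : ∀ {m} (u v : Vec ℕ m) → (∀ k → lookup u k ≤ lookup v k) → Pw.Pointwise _≤_ (V.toList u) (V.toList v)
    cell []      []      _ = Pw.[]
    cell (x ∷ u) (y ∷ v) f = f F.zero Pw.∷ cell u v (λ k → f (F.suc k))
    row : ∀ {m} (u v : Vec (Vec ℕ n) m) → (∀ j k → lookup (lookup u j) k ≤ lookup (lookup v j) k) →
      Pw.Pointwise _≤_ (flatRow u) (flatRow v)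
    row []      []      _ = Pw.[]
    row (x ∷ u) (y ∷ v) f = Pw.++⁺ (cell x y (f F.zero)) (row u v (λ j → f (F.suc j)))
    rows : ∀ {m} (u v : Vec (Vec (Vec ℕ n) s) m) →
      (∀ i j k → lookup (lookup (lookup u i) j) k ≤ lookup (lookup (lookup v i) j) k) →
      Pw.Pointwise _≤_ (flatRows u) (flatRows v)
    rows []      []      _ = Pw.[]
    rows (x ∷ u) (y ∷ v) f = subst₂ (Pw.Pointwise _≤_) (sym (flatRows-∷ x u)) (sym (flatRows-∷ y v))
                               (Pw.++⁺ (row x y (f F.zero)) (rows u v (λ i → f (F.suc i))))
  ... | inj₂ μ<ν = inj₂ μ<ν
  ... | inj₁ e   = inj₁ (∣ₘ-deg-≡ {μ} {ν} μ∣ν (cong LA.sum e))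

lex-asym : ∀ {xs ys} → LexLt xs ys → LexLt ys xs → ⊥
lex-asym (here x<y)  (here y<x)  = NP.<-asym x<y y<x
lex-asym (here x<x)  (there _)   = NP.<-irrefl refl x<x
lex-asym (there _)   (here x<x)  = NP.<-irrefl refl x<x
lex-asym (there xs<ys) (there ys<xs) = lex-asym xs<ys ys<xs

module SquareFree (r s n : ℕ) where
  open Arrays r s n
  open Evaluation r s n
  open Variety r s n
  open Degrees r s n

  isPos : ℕ → Bool
  isPos zero    = false
  isPos (suc _) = true

  bit : Bool → ℕ
  bit false = 0
  bit true  = 1

  support : Mn → Pt
  support = map3 isPos

  sqMono : Pt → Mn
  sqMono = map3 bit

  monoOf : Rc → Mn
  monoOf P = sqMono (toPoint P)

  Std : Mn → Set
  Std μ = Σ Pt λ a → ConflictFree a × μ ≡ sqMono a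

  at-support : ∀ μ i j k → at (support μ) i j k ≡ isPos (at μ i j k)
  at-support = at-map3 isPos

  at-sqMono : ∀ a i j k → at (sqMono a) i j k ≡ bit (at a i j k)
  at-sqMono = at-map3 bit

  support-sqMono : ∀ a → support (sqMono a) ≡ a
  support-sqMono a = array-ext λ i j k →
    trans (at-support (sqMono a) i j k) (trans (cong isPos (at-sqMono a i j k)) (isPos-bit (at a i j k)))
    where isPos-bit : ∀ b → isPos (bit b) ≡ b
          isPos-bit false = refl
          isPos-bit true  = refl

  sqMono-injective : ∀ a b → sqMono a ≡ sqMono b → a ≡ b
  sqMono-injective a b e = trans (sym (support-sqMono a)) (trans (cong support e) (support-sqMono b))

  monoOf-injective : ∀ P Q → monoOf P ≡ monoOf Q → P ≡ Q
  monoOf-injective P Q e = toPoint-injective P Q (sqMono-injective _ _ e)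

  evalMon-sqMono : ∀ a b → evalMon a (sqMono b) ≡ true → sqMono b ∣ₘ sqMono a
  evalMon-sqMono a b e i j k = subst₂ _≤_ (sym (at-sqMono b i j k)) (sym (at-sqMono a i j k))
    (bit-mono (at b i j k) (at a i j k)
      (λ bijk → evalMon-true a (sqMono b) e i j k (λ z → bit-true≢0 (trans (cong bit (sym bijk)) (trans (sym (at-sqMono b i j k)) z)))))
    where
    bit-true≢0 : bit true ≢ 0
    bit-true≢0 ()
    bit-mono : ∀ x y → (x ≡ true → y ≡ true) → bit x ≤ bit y
    bit-mono false _ _ = z≤n
    bit-mono true  y f rewrite f refl = s≤s z≤n

  evalMon-sqMono-self : ∀ a → evalMon a (sqMono a) ≡ true
  evalMon-sqMono-self a = evalMon-intro a (sqMono a) λ i j k ≢0 →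
    bit≢0 (at a i j k) (λ z → ≢0 (trans (at-sqMono a i j k) z))
    where bit≢0 : ∀ x → bit x ≢ 0 → x ≡ true
          bit≢0 false ne = ⊥-elim (ne refl)
          bit≢0 true  _  = refl

  sqMono-support-∣ₘ : ∀ μ → sqMono (support μ) ∣ₘ μ
  sqMono-support-∣ₘ μ i j k = subst (_≤ at μ i j k)
    (sym (trans (at-sqMono (support μ) i j k) (cong bit (at-support μ i j k)))) (bit-isPos (at μ i j k))
    where bit-isPos : ∀ e → bit (isPos e) ≤ e
          bit-isPos zero    = z≤n
          bit-isPos (suc e) = s≤s z≤n

  deg-monoOf : ∀ P → deg (monoOf P) ≡ size P
  deg-monoOf P = trans (deg≡total (monoOf P))
    (sum-map-cong rowDeg (λ row → V.sum (V.map filled′ row)) (monoOf P) P λ i →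
      sum-map-cong cellDeg filled′ (lookup (monoOf P) i) (lookup P i) λ j →
        cellDeg-indicator (lookup (lookup (monoOf P) i) j) (entry P i j) λ k →
          trans (at-sqMono (toPoint P) i j k) (cong bit (at-toPoint P i j k)))
    where
    filled′ : Maybe (Fin n) → ℕ
    filled′ = filled {r} {s} {n}
    isK-other : ∀ k₀ t → t ≢ k₀ → isK′ (just k₀) t ≡ false
    isK-other k₀ t t≢k₀ with k₀ F.≟ t
    ... | yes k₀≡t = ⊥-elim (t≢k₀ (sym k₀≡t))
    ... | no _     = refl
    cellDeg-indicator : ∀ (w : Vec ℕ n) e → (∀ k → lookup w k ≡ bit (isK′ e k)) → cellDeg w ≡ filled′ e
    cellDeg-indicator w e f = trans (cong cellDeg (vec-ext {u = w} {v = tabulate (λ k → bit (isK′ e k))} λ k → trans (f k) (sym (VP.lookup∘tabulate _ k))))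
                                  (indicator-sum e)
      where
      indicator-sum : ∀ e → cellDeg (tabulate (λ k → bit (isK′ e k))) ≡ filled′ e
      indicator-sum nothing   = sum-map-tabulate-zero (λ e → e) (λ k → bit (isK′ nothing k)) (λ _ → refl)
      indicator-sum (just k₀) = trans (sum-map-tabulate-single (λ e → e) (λ k → bit (isK′ (just k₀) k)) k₀
                                 (λ t t≢k₀ → cong bit (isK-other k₀ t t≢k₀)))
                              (cong bit (isK-self k₀))

-- Every monomial is congruent modulo I to its normal
-- form: 0 if its support has a conflict (a quadratic generator divides it),
-- and x^{support μ} otherwise (the relations x² ≡ x lower exponents).
module Reduction (r s n : ℕ) where
  open Arrays r s n
  open Ideals r s n
  open Variety r s n
  open Degrees r s n
  open SquareFree r s n

  varProduct-∣ₘ : ∀ μ i j k i′ j′ k′ → ¬ SameCell i j k i′ j′ k′ →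
    1 ≤ at μ i j k → 1 ≤ at μ i′ j′ k′ → (var i j k *ₘ var i′ j′ k′) ∣ₘ μ
  varProduct-∣ₘ μ i j k i′ j′ k′ diff p q x y z
    rewrite at-mul (var i j k) (var i′ j′ k′) x y z with sameCell? i j k x y z | sameCell? i′ j′ k′ x y z
  ... | yes (refl , refl , refl) | yes (refl , refl , refl) = ⊥-elim (diff (refl , refl , refl))
  ... | yes (refl , refl , refl) | no d′ rewrite var-same i j k | var-other i′ j′ k′ i j k d′ = p
  ... | no d | yes (refl , refl , refl) rewrite var-other i j k i′ j′ k′ d | var-same i′ j′ k′ = q
  ... | no d | no d′ rewrite var-other i j k x y z d | var-other i′ j′ k′ x y z d′ = z≤n

  varSquare-∣ₘ : ∀ μ i j k → 2 ≤ at μ i j k → (var i j k *ₘ var i j k) ∣ₘ μ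
  varSquare-∣ₘ μ i j k two x y z rewrite at-mul (var i j k) (var i j k) x y z with sameCell? i j k x y z
  ... | yes (refl , refl , refl) rewrite var-same i j k = two
  ... | no d rewrite var-other i j k x y z d = z≤n

  support-pos : ∀ μ i j k → at (support μ) i j k ≡ true → 1 ≤ at μ i j k
  support-pos μ i j k p with at μ i j k | at-support μ i j k
  ... | suc _ | _ = s≤s z≤n
  ... | zero  | e = ⊥-elim (true≢false (trans (sym p) e))

  conflictMono-∣ₘ : ∀ μ (c : Conflict (support μ)) → conflictMono (support μ) c ∣ₘ μ
  conflictMono-∣ₘ μ (inj₁ (i , j , k , k′ , k<k′ , p , q)) =
    varProduct-∣ₘ μ i j k i j k′ (λ (_ , _ , e) → <⇒≢ k<k′ e) (support-pos μ i j k p) (support-pos μ i j k′ q)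
  conflictMono-∣ₘ μ (inj₂ (inj₁ (i , j , j′ , k , j<j′ , p , q))) =
    varProduct-∣ₘ μ i j k i j′ k (λ (_ , e , _) → <⇒≢ j<j′ e) (support-pos μ i j k p) (support-pos μ i j′ k q)
  conflictMono-∣ₘ μ (inj₂ (inj₂ (i , i′ , j , k , i<i′ , p , q))) =
    varProduct-∣ₘ μ i j k i′ j k (λ (e , _ , _) → <⇒≢ i<i′ e) (support-pos μ i j k p) (support-pos μ i′ j k q)

  data Shape (μ : Mn) : Set where
    conflicting : (c : Conflict (support μ)) → Shape μ
    squared     : ∀ i j k → 2 ≤ at μ i j k → Shape μ
    standard    : ConflictFree (support μ) → μ ≡ sqMono (support μ) → Shape μ

  shape : ∀ μ → Shape μ
  shape μ with conflict? (support μ)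
  ... | yes c  = conflicting c
  ... | no cf with FP.any? (λ i → FP.any? (λ j → FP.any? (λ k → 2 ≤? at μ i j k)))
  ...   | yes (i , j , k , two) = squared i j k two
  ...   | no none = standard cf (array-ext λ i j k →
            trans (square-free (at μ i j k) (λ two → none (i , j , k , two)))
                  (sym (trans (at-sqMono (support μ) i j k) (cong bit (at-support μ i j k)))))
    where square-free : ∀ e → ¬ (2 ≤ e) → e ≡ bit (isPos e)
          square-free zero          _ = refl
          square-free (suc zero)    _ = refl
          square-free (suc (suc e)) h = ⊥-elim (h (s≤s (s≤s z≤n)))

  nfPt : Pt → Pl
  nfPt a with conflict? a
  ... | yes _ = L.[]
  ... | no _  = sqMono a L.∷ L.[]

  nfPt-conflict : ∀ a → Conflict a → nfPt a ≡ L.[]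
  nfPt-conflict a c with conflict? a
  ... | yes _ = refl
  ... | no cf = ⊥-elim (cf c)

  nfPt-free : ∀ a → ConflictFree a → nfPt a ≡ sqMono a L.∷ L.[]
  nfPt-free a cf with conflict? a
  ... | yes c = ⊥-elim (cf c)
  ... | no _  = refl

  nf : Mn → Pl
  nf μ = nfPt (support μ)

  nfPoly : Pl → Pl
  nfPoly = concatMap nf

  -- Using x² ≡ x once: if x² ∣ μ then μ ≡ μ/x, a monomial of smaller
  -- degree with the same support.
  lower-square : ∀ μ i j k → 2 ≤ at μ i j k →
    Σ Mn λ μ₁ → Ideal (μ L.∷ μ₁ L.∷ L.[]) × support μ₁ ≡ support μ × deg μ₁ < deg μ
  lower-square μ i j k two = μ₁ , ideal-μμ₁ , support-eq , ∣ₘ-deg-< {μ₁} {μ} μ₁∣μ μ₁≢μ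
    where
    x = var {r} {s} {n} i j k
    q = μ /ₘ (x *ₘ x)
    μ₁ = q *ₘ x
    ideal-μμ₁ : Ideal (μ L.∷ μ₁ L.∷ L.[])
    ideal-μμ₁ = subst (λ z → Ideal (z L.∷ μ₁ L.∷ L.[])) (sym (∣ₘ-quotient {x *ₘ x} {μ} (varSquare-∣ₘ μ i j k two)))
                  (ideal-multiple (q L.∷ L.[]) (gsq i j k))
    at-μ₁ : ∀ x′ y′ z′ → at μ₁ x′ y′ z′ ≡ at μ x′ y′ z′ ∸ (at x x′ y′ z′ + at x x′ y′ z′) + at x x′ y′ z′
    at-μ₁ x′ y′ z′ = trans (at-mul q x x′ y′ z′)
      (cong (_+ at x x′ y′ z′) (trans (at-zip3 _∸_ μ (x *ₘ x) x′ y′ z′) (cong (at μ x′ y′ z′ ∸_) (at-mul x x x′ y′ z′))))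
    at-μ₁-same : at μ₁ i j k ≡ at μ i j k ∸ 2 + 1
    at-μ₁-same = trans (at-μ₁ i j k) (cong (λ t → at μ i j k ∸ (t + t) + t) (var-same i j k))
    at-μ₁-other : ∀ x′ y′ z′ → ¬ SameCell i j k x′ y′ z′ → at μ₁ x′ y′ z′ ≡ at μ x′ y′ z′
    at-μ₁-other x′ y′ z′ d = trans (at-μ₁ x′ y′ z′)
      (trans (cong (λ t → at μ x′ y′ z′ ∸ (t + t) + t) (var-other i j k x′ y′ z′ d)) (NP.+-identityʳ _))
    lowered : ∀ e → 2 ≤ e → e ∸ 2 + 1 ≤ e × e ∸ 2 + 1 ≢ e × isPos (e ∸ 2 + 1) ≡ isPos e
    lowered (suc zero) (s≤s ())
    lowered (suc (suc e)) _ = subst (_≤ 2 + e) (NP.+-comm 1 e) (NP.n≤1+n (suc e)) ,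
                              (λ eq → NP.1+n≢n (sym (trans (NP.+-comm 1 e) eq))) ,
                              pos e
      where pos : ∀ e → isPos (e + 1) ≡ true
            pos zero    = refl
            pos (suc _) = refl
    μ₁∣μ : μ₁ ∣ₘ μ
    μ₁∣μ x′ y′ z′ with sameCell? i j k x′ y′ z′
    ... | yes (refl , refl , refl) = subst (_≤ at μ i j k) (sym at-μ₁-same) (proj₁ (lowered _ two))
    ... | no d = NP.≤-reflexive (at-μ₁-other x′ y′ z′ d)
    μ₁≢μ : μ₁ ≢ μ
    μ₁≢μ e = proj₁ (proj₂ (lowered _ two)) (trans (sym at-μ₁-same) (cong (λ z → at z i j k) e))
    support-eq : support μ₁ ≡ support μ
    support-eq = array-ext λ x′ y′ z′ → trans (at-support μ₁ x′ y′ z′) (trans (pos-eq x′ y′ z′) (sym (at-support μ x′ y′ z′)))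
      where pos-eq : ∀ x′ y′ z′ → isPos (at μ₁ x′ y′ z′) ≡ isPos (at μ x′ y′ z′)
            pos-eq x′ y′ z′ with sameCell? i j k x′ y′ z′
            ... | yes (refl , refl , refl) = trans (cong isPos at-μ₁-same) (proj₂ (proj₂ (lowered _ two)))
            ... | no d = cong isPos (at-μ₁-other x′ y′ z′ d)

  nf-ideal : ∀ μ → Ideal (μ L.∷ nf μ)
  nf-ideal μ = <-rec (λ d → ∀ μ → deg μ ≡ d → Ideal (μ L.∷ nf μ)) step (deg μ) μ refl
    where
    step : ∀ d → (∀ {d′} → d′ < d → ∀ μ → deg μ ≡ d′ → Ideal (μ L.∷ nf μ)) → ∀ μ → deg μ ≡ d → Ideal (μ L.∷ nf μ)
    step d ih μ deg≡ with shape μ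
    ... | conflicting c = subst (λ z → Ideal (μ L.∷ z)) (sym (nfPt-conflict (support μ) c))
            (subst (λ z → Ideal (z L.∷ L.[])) (sym (∣ₘ-quotient {lm} {μ} (conflictMono-∣ₘ μ c)))
              (subst (λ p → Ideal ((μ /ₘ lm L.∷ L.[]) *ₚ p)) (gen-conflictGen (support μ) c)
                (ideal-multiple (μ /ₘ lm L.∷ L.[]) (conflictGen (support μ) c))))
      where lm = conflictMono (support μ) c
    ... | standard cf μ≡ = ideal-resp {μ L.∷ nf μ} {L.[]} (λ ν →
            trans (cong (λ z → coeffOf (μ L.∷ z) ν) (trans (nfPt-free (support μ) cf) (cong (L._∷ L.[]) (sym μ≡))))
                  (xor-absorb (does (μ ≟ₘ ν)) false)) ideal-zero
    ... | squared i j k two with lower-square μ i j k two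
    ...   | μ₁ , ideal-μμ₁ , support-eq , deg< =
      ideal-resp {μ L.∷ nf μ} {(μ L.∷ μ₁ L.∷ L.[]) ++ (μ₁ L.∷ nf μ₁)} (λ ν →
        trans (cong (λ z → coeffOf (μ L.∷ z) ν) (sym (cong nfPt support-eq)))
          (trans (regroup (does (μ ≟ₘ ν)) (does (μ₁ ≟ₘ ν)) (coeffOf (nf μ₁) ν))
                 (sym (coeff-++ (μ L.∷ μ₁ L.∷ L.[]) (μ₁ L.∷ nf μ₁) ν))))
        (ideal-++ {μ L.∷ μ₁ L.∷ L.[]} {μ₁ L.∷ nf μ₁} ideal-μμ₁ (ih (subst (deg μ₁ <_) deg≡ deg<) μ₁ refl))
      where
      open xor-∧-Solver using (solve; _:+_; _:=_; con)
      regroup : ∀ a b c → a xor c ≡ (a xor (b xor false)) xor (b xor c)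
      regroup = solve 3 (λ a b c → a :+ c := (a :+ (b :+ con false)) :+ (b :+ c)) refl

  nfPoly-ideal : ∀ p → Ideal (p ++ nfPoly p)
  nfPoly-ideal L.[]       = ideal-zero
  nfPoly-ideal (μ L.∷ p) =
    ideal-resp {(μ L.∷ p) ++ nfPoly (μ L.∷ p)} {(μ L.∷ nf μ) ++ (p ++ nfPoly p)} (λ ν →
      trans (cong (does (μ ≟ₘ ν) xor_) (trans (coeff-++ p (nf μ ++ nfPoly p) ν) (cong (coeffOf p ν xor_) (coeff-++ (nf μ) (nfPoly p) ν))))
        (trans (xor-interchange (does (μ ≟ₘ ν)) (coeffOf p ν) (coeffOf (nf μ) ν) (coeffOf (nfPoly p) ν))
          (sym (trans (coeff-++ (μ L.∷ nf μ) (p ++ nfPoly p) ν) (cong (coeffOf (μ L.∷ nf μ) ν xor_) (coeff-++ p (nfPoly p) ν))))))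
      (ideal-++ {μ L.∷ nf μ} {p ++ nfPoly p} (nf-ideal μ) (nfPoly-ideal p))

  nfPt-std : ∀ a ν → coeffOf (nfPt a) ν ≡ true → ConflictFree a × sqMono a ≡ ν
  nfPt-std a ν e with conflict? a
  ... | no cf = cf , does-true (trans (sym (xor-identityʳ _)) e)

  nfPoly-std : ∀ p ν → coeffOf (nfPoly p) ν ≡ true → Std ν
  nfPoly-std p ν e with parity-true (λ μ → coeffOf (nf μ) ν) p (trans (sym (parity-concatMap (λ x → does (x ≟ₘ ν)) nf p)) e)
  ... | μ , e′ with nfPt-std (support μ) ν e′
  ...   | cf , eq = support μ , cf , sym eq

-- The decisive fact is triangularity: evaluating at the
-- conflict-free point a detects exactly the standard monomials dividing x^a.
module InitialIdeal (r s n : ℕ) where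
  open Arrays r s n
  open Evaluation r s n
  open Ideals r s n
  open Variety r s n
  open Degrees r s n
  open SquareFree r s n
  open Reduction r s n

  -- If g is a combination of standard monomials vanishing at every
  -- conflict-free point, then every standard monomial has coefficient 0 in g
  -- (induction on degree: at a, the only standard monomials that evaluate
  -- to 1 are x^a and divisors of smaller degree).
  vanishing-std-combination : ∀ g → (∀ ν → coeffOf g ν ≡ true → Std ν) →
    (∀ a → ConflictFree a → eval a g ≡ false) → ∀ a → ConflictFree a → coeffOf g (sqMono a) ≡ false
  vanishing-std-combination g std vanishes a₀ cf₀ =
    <-rec (λ d → ∀ a → ConflictFree a → deg (sqMono a) ≡ d → coeffOf g (sqMono a) ≡ false) step _ a₀ cf₀ refl
    where
    step : ∀ d → (∀ {d′} → d′ < d → ∀ a → ConflictFree a → deg (sqMono a) ≡ d′ → coeffOf g (sqMono a) ≡ false) →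
           ∀ a → ConflictFree a → deg (sqMono a) ≡ d → coeffOf g (sqMono a) ≡ false
    step d ih a cf deg≡ = begin
      coeffOf g m                   ≡⟨ sym (cong (_∧ coeffOf g m) (evalMon-sqMono-self a)) ⟩
      evalMon a m ∧ coeffOf g m     ≡⟨ sym (parity-concentrated (evalMon a) g m smaller-vanish) ⟩
      eval a g                      ≡⟨ vanishes a cf ⟩
      false                         ∎
      where
      open ≡-Reasoning
      m = sqMono a
      smaller-vanish : ∀ ν → evalMon a ν ≡ true → ν ≢ m → coeffOf g ν ≡ false
      smaller-vanish ν ev ν≢m with coeffOf g ν in gν
      ... | false = refl
      ... | true with std ν gν
      ...   | b , cfb , refl = trans (sym gν) (ih smaller b cfb refl)
        where smaller = subst (deg (sqMono b) <_) deg≡ (∣ₘ-deg-< {sqMono b} {m} (evalMon-sqMono a b ev) ν≢m)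

  -- If m = x^a, with a conflict-free, is the leading monomial of f, then m
  -- survives in the normal form of f: every other monomial of f reducing to
  -- m is a multiple of m, hence lexicographically larger than m.
  nfPoly-keeps-leading : ∀ f a → ConflictFree a → LM f (sqMono a) → coeffOf (nfPoly f) (sqMono a) ≡ true
  nfPoly-keeps-leading f a cf (lead , maximal) = begin
    coeffOf (nfPoly f) m              ≡⟨ parity-concatMap (λ x → does (x ≟ₘ m)) nf f ⟩
    parity (λ ν → coeffOf (nf ν) m) f ≡⟨ parity-concentrated (λ ν → coeffOf (nf ν) m) f m others ⟩
    coeffOf (nf m) m ∧ coeffOf f m    ≡⟨ cong₂ _∧_ nf-m (trans (sym (coeff≡coeffOf f m)) lead) ⟩
    true                              ∎
    where
    open ≡-Reasoning
    m = sqMono a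
    nf-m : coeffOf (nf m) m ≡ true
    nf-m = trans (cong (λ z → coeffOf (nfPt z) m) (support-sqMono a))
             (trans (cong (λ z → coeffOf z m) (nfPt-free a cf)) (trans (coeff-single m m) (does-refl m)))
    others : ∀ ν → coeffOf (nf ν) m ≡ true → ν ≢ m → coeffOf f ν ≡ false
    others ν reduces ν≢m with coeffOf f ν in fν
    ... | false = refl
    ... | true with maximal ν (trans (coeff≡coeffOf f ν) fν)
                  | ∣ₘ⇒lex {m} {ν} (subst (_∣ₘ ν) (proj₂ (nfPt-std (support ν) m reduces)) (sqMono-support-∣ₘ ν))
    ...   | inj₁ ν≡m  | _          = ⊥-elim (ν≢m ν≡m)
    ...   | inj₂ _    | inj₁ m≡ν   = ⊥-elim (ν≢m (sym m≡ν))
    ...   | inj₂ ν<m  | inj₂ m<ν   = ⊥-elim (lex-asym ν<m m<ν)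

  no-std-leading : ∀ f → Ideal f → ∀ a → ConflictFree a → ¬ LM f (sqMono a)
  no-std-leading f f∈I a cf lm = true≢false (trans (sym (nfPoly-keeps-leading f a cf lm))
    (vanishing-std-combination (nfPoly f) (nfPoly-std f) (λ b cfb → ideal-vanishes b cfb (nfPoly f) nf∈I) a cf))
    where
    -- nfPoly f = f + (f + nfPoly f) ∈ I
    nf∈I : Ideal (nfPoly f)
    nf∈I = ideal-resp {nfPoly f} {f ++ (f ++ nfPoly f)}
      (λ ν → sym (trans (coeff-++ f (f ++ nfPoly f) ν)
                   (trans (cong (coeffOf f ν xor_) (coeff-++ f (nfPoly f) ν)) (xor-absorb (coeffOf f ν) _))))
      (ideal-++ {f} {f ++ nfPoly f} f∈I (nfPoly-ideal f))

  InInitialIdeal : Pl → Set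
  InInitialIdeal p = p ∈⟨ InitGens (IGens r s n) ⟩

  LM-single : ∀ μ → LM (μ L.∷ L.[]) μ
  LM-single μ = trans (coeff≡coeffOf (μ L.∷ L.[]) μ) (trans (coeff-single μ μ) (does-refl μ)) ,
    λ ν e → inj₁ (sym (does-true (trans (sym (coeff-single μ ν)) (trans (sym (coeff≡coeffOf (μ L.∷ L.[]) ν)) e))))

  LM-square : ∀ i j k → LM (gen (gsq i j k)) (var i j k *ₘ var i j k)
  LM-square i j k = trans (coeff≡coeffOf (gen (gsq i j k)) xx)
      (cong₂ _xor_ (does-refl xx) (trans (coeff-single x xx) (does-≢ x≢xx))) ,
    λ ν e → below (xx ≟ₘ ν) (x ≟ₘ ν) e
    where
    x = var {r} {s} {n} i j k
    xx = x *ₘ x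
    x≢xx : x ≢ xx
    x≢xx e with trans (sym (var-same i j k)) (trans (cong (λ z → at z i j k) e) (trans (at-mul x x i j k) (cong (λ t → t + t) (var-same i j k))))
    ... | ()
    below : ∀ {ν} → Dec (xx ≡ ν) → Dec (x ≡ ν) → coeff (gen (gsq i j k)) ν ≡ true → ν ≡ xx ⊎ ν <ₘ xx
    below (yes xx≡ν) _ _ = inj₁ (sym xx≡ν)
    below (no _) (yes refl) _ with ∣ₘ⇒lex {x} {xx} (∣ₘ-*ₘ x x)
    ... | inj₁ x≡xx = ⊥-elim (x≢xx x≡xx)
    ... | inj₂ x<xx = inj₂ x<xx
    below {ν} (no xx≢ν) (no x≢ν) e with trans (cong₂ (λ b c → b xor (c xor false)) (sym (does-≢ xx≢ν)) (sym (does-≢ x≢ν)))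
                                          (trans (sym (coeff≡coeffOf (gen (gsq i j k)) ν)) e)
    ... | ()

  multiple-initial : ∀ μ q lm g → LM (gen g) lm → μ ≡ q *ₘ lm → InInitialIdeal (μ L.∷ L.[])
  multiple-initial μ q lm g lead μ≡ =
    (q L.∷ L.[] , lm L.∷ L.[] , lm , refl , gen g , ideal-gen g , lead) L.∷ L.[] ,
    λ ν → cong (λ z → coeff (z L.∷ L.[]) ν) μ≡

  standard⇒std : ∀ μ → Standard (IGens r s n) μ → Std μ
  standard⇒std μ st with shape μ
  ... | conflicting c = ⊥-elim (st (multiple-initial μ _ lm (conflictGen (support μ) c)
          (subst (λ p → LM p lm) (sym (gen-conflictGen (support μ) c)) (LM-single lm))
          (∣ₘ-quotient {lm} {μ} (conflictMono-∣ₘ μ c))))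
    where lm = conflictMono (support μ) c
  ... | squared i j k two = ⊥-elim (st (multiple-initial μ _ _ (gsq i j k) (LM-square i j k)
          (∣ₘ-quotient {var i j k *ₘ var i j k} {μ} (varSquare-∣ₘ μ i j k two))))
  ... | standard cf μ≡ = support μ , cf , μ≡

  conflictFree-below : ∀ a b → (∀ i j k → at b i j k ≡ true → at a i j k ≡ true) → ConflictFree a → ConflictFree b
  conflictFree-below a b b≤a cf (inj₁ (i , j , k , k′ , lt , p , q)) = cf (inj₁ (i , j , k , k′ , lt , b≤a _ _ _ p , b≤a _ _ _ q))
  conflictFree-below a b b≤a cf (inj₂ (inj₁ (i , j , j′ , k , lt , p , q))) = cf (inj₂ (inj₁ (i , j , j′ , k , lt , b≤a _ _ _ p , b≤a _ _ _ q)))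
  conflictFree-below a b b≤a cf (inj₂ (inj₂ (i , i′ , j , k , lt , p , q))) = cf (inj₂ (inj₂ (i , i′ , j , k , lt , b≤a _ _ _ p , b≤a _ _ _ q)))

  divisor-std : ∀ a → ConflictFree a → ∀ lm → lm ∣ₘ sqMono a → Std lm
  divisor-std a cf lm lm∣ = support lm , conflictFree-below a (support lm) below cf , lm≡
    where
    bit≤1 : ∀ x → bit x ≤ 1
    bit≤1 false = z≤n
    bit≤1 true  = s≤s z≤n
    lm≤bit : ∀ i j k → at lm i j k ≤ bit (at a i j k)
    lm≤bit i j k = subst (at lm i j k ≤_) (at-sqMono a i j k) (lm∣ i j k)
    below : ∀ i j k → at (support lm) i j k ≡ true → at a i j k ≡ true
    below i j k p with at a i j k | lm≤bit i j k | support-pos lm i j k p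
    ... | true  | _  | _   = refl
    ... | false | le | pos = ⊥-elim (NP.<-irrefl refl (NP.≤-trans pos le))
    lm≡ : lm ≡ sqMono (support lm)
    lm≡ = array-ext λ i j k → trans (at≤1 (at lm i j k) (NP.≤-trans (lm≤bit i j k) (bit≤1 (at a i j k))))
            (sym (trans (at-sqMono (support lm) i j k) (cong bit (at-support lm i j k))))
      where at≤1 : ∀ e → e ≤ 1 → e ≡ bit (isPos e)
            at≤1 zero          _ = refl
            at≤1 (suc zero)    _ = refl
            at≤1 (suc (suc e)) (s≤s ())

  std⇒standard : ∀ a → ConflictFree a → Standard (IGens r s n) (sqMono a)
  std⇒standard a cf (cs , m≈) with parity-true (λ c → coeffOf (term′ c) m) cs
      (trans (sym (parity-concatMap (λ x → does (x ≟ₘ m)) term′ cs))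
        (trans (sym (coeff≡coeffOf (sumₚ (map term′ cs)) m))
          (trans (sym (m≈ m)) (trans (coeff≡coeffOf (m L.∷ L.[]) m) (trans (coeff-single m m) (does-refl m))))))
    where
    m = sqMono a
    term′ : Pl × Σ Pl (InitGens (IGens r s n)) → Pl
    term′ (q , g , _) = q *ₚ g
  ... | (q , .(lm L.∷ L.[]) , lm , refl , f , f∈I , lead) , hit
    with parity-true (λ ν → coeffOf (map (ν *ₘ_) (lm L.∷ L.[])) (sqMono a)) q
           (trans (sym (parity-concatMap (λ x → does (x ≟ₘ sqMono a)) (λ ν → map (ν *ₘ_) (lm L.∷ L.[])) q)) hit)
  ... | ν , νlm≡ with divisor-std a cf lm (subst (lm ∣ₘ_) (does-true {ν *ₘ lm} {sqMono a} (trans (sym (xor-identityʳ _)) νlm≡)) (∣ₘ-*ₘ ν lm))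
  ...   | b , cfb , refl = no-std-leading f f∈I b cfb lead

-- The monomials x^P of the partial Latin rectangles P form an
-- 𝔽₂-basis of 𝔽₂[x]/I: they span by reduction to normal forms and are
-- independent by triangularity.
module Counting (r s n : ℕ) where
  open Arrays r s n
  open Ideals r s n
  open Variety r s n
  open SquareFree r s n
  open Reduction r s n
  open InitialIdeal r s n

  rectangles : Enum Rc
  rectangles = enumVec (enumVec (enumMaybe (enumFin n)) s) r

  plr-count : Σ ℕ (Card (IsPLR {r} {s} {n}))
  plr-count = count rectangles isPLR?

  N : ℕ
  N = proj₁ plr-count

  plrs : Vec Rc N
  plrs = proj₁ (proj₂ plr-count)

  plr : Fin N → Rc
  plr = lookup plrs

  plr-isPLR : ∀ t → IsPLR (plr t)
  plr-isPLR = proj₁ (proj₂ (proj₂ plr-count))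

  plr-injective : ∀ t u → plr t ≡ plr u → t ≡ u
  plr-injective = proj₁ (proj₂ (proj₂ (proj₂ plr-count)))

  plr-onto : ∀ P → IsPLR P → Σ (Fin N) λ t → plr t ≡ P
  plr-onto = proj₂ (proj₂ (proj₂ (proj₂ plr-count)))

  std-plr : ∀ ν → Std ν → Σ (Fin N) λ t → monoOf (plr t) ≡ ν
  std-plr ν (b , cfb , ν≡) with plr-onto (fromPoint b) (fromPoint-PLR b cfb)
  ... | t , plr-t = t , trans (cong monoOf plr-t) (trans (cong sqMono (toPoint-fromPoint b cfb)) (sym ν≡))

  std? : ∀ ν → Std ν ⊎ ¬ Std ν
  std? ν with shape ν
  ... | conflicting c  = inj₂ λ (b , cfb , ν≡) → cfb (subst Conflict (trans (cong support ν≡) (support-sqMono b)) c)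
  ... | squared i j k two = inj₂ λ (b , cfb , ν≡) →
          bit≤1 (at b i j k) (subst (2 ≤_) (trans (cong (λ z → at z i j k) ν≡) (at-sqMono b i j k)) two)
    where bit≤1 : ∀ x → 2 ≤ bit x → ⊥
          bit≤1 false ()
          bit≤1 true  (s≤s ())
  ... | standard cf ν≡ = inj₁ (support ν , cf , ν≡)

  basis : Vec Pl N
  basis = V.map (λ P → monoOf P L.∷ L.[]) plrs

  coeff-basis : ∀ t ν → coeffOf (lookup basis t) ν ≡ does (monoOf (plr t) ≟ₘ ν)
  coeff-basis t ν = trans (cong (λ z → coeffOf z ν) (VP.lookup-map t (λ P → monoOf P L.∷ L.[]) plrs))
                          (coeff-single (monoOf (plr t)) ν)

  coeff-comb : ∀ {K} (S : Vec Bool K) (b : Vec Pl K) ν →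
    coeffOf (comb S b) ν ≡ parityFin (λ t → lookup S t ∧ coeffOf (lookup b t) ν)
  coeff-comb []      []      ν = refl
  coeff-comb (c ∷ S) (p ∷ b) ν = trans (coeff-++ (if c then p else L.[]) (comb S b) ν) (cong₂ _xor_ (chosen c) (coeff-comb S b ν))
    where chosen : ∀ c → coeffOf (if c then p else L.[]) ν ≡ c ∧ coeffOf p ν
          chosen false = refl
          chosen true  = refl

  comb-coeff-basis : ∀ S t₀ → coeffOf (comb S basis) (monoOf (plr t₀)) ≡ lookup S t₀
  comb-coeff-basis S t₀ = trans (coeff-comb S basis _)
    (trans (parityFin-single _ t₀ λ t t≢t₀ → trans (cong (lookup S t ∧_)
              (trans (coeff-basis t _) (does-≢ λ e → t≢t₀ (plr-injective t t₀ (monoOf-injective _ _ e)))))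
              (∧-zeroʳ (lookup S t)))
      (trans (cong (lookup S t₀ ∧_) (trans (coeff-basis t₀ _) (does-refl (monoOf (plr t₀))))) (∧-identityʳ _)))

  comb-std : ∀ S ν → coeffOf (comb S basis) ν ≡ true → Std ν
  comb-std S ν e with parityFin-true _ (trans (sym (coeff-comb S basis ν)) e)
  ... | t , hit = toPoint (plr t) , PLR⇒conflictFree (plr t) (plr-isPLR t) ,
                  sym (does-true (trans (sym (coeff-basis t ν)) (∧-conicalʳ (lookup S t) _ hit)))

  -- Spanning: p ≡ ∑_t S_t x^{P_t} modulo I, where S_t is the coefficient of
  -- x^{P_t} in the normal form of p.
  spanning : ∀ p → Σ (Vec Bool N) λ S → Ideal (p +ₚ comb S basis)
  spanning p = S , ideal-resp {p ++ comb S basis} {p ++ nfPoly p}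
    (λ ν → trans (coeff-++ p (comb S basis) ν) (trans (cong (coeffOf p ν xor_) (same ν)) (sym (coeff-++ p (nfPoly p) ν))))
    (nfPoly-ideal p)
    where
    S : Vec Bool N
    S = tabulate λ t → coeffOf (nfPoly p) (monoOf (plr t))
    absent : ∀ q → (∀ ν → coeffOf q ν ≡ true → Std ν) → ∀ ν → ¬ Std ν → coeffOf q ν ≡ false
    absent q std ν ¬std with coeffOf q ν in qν
    ... | false = refl
    ... | true  = ⊥-elim (¬std (std ν qν))
    same : ∀ ν → coeffOf (comb S basis) ν ≡ coeffOf (nfPoly p) ν
    same ν with std? ν
    ... | inj₂ ¬std = trans (absent (comb S basis) (comb-std S) ν ¬std) (sym (absent (nfPoly p) (nfPoly-std p) ν ¬std))
    ... | inj₁ std with std-plr ν std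
    ...   | t , refl = trans (comb-coeff-basis S t) (VP.lookup∘tabulate _ t)

  -- Independence: a combination of the basis lying in I vanishes at all
  -- conflict-free points, so all of its coefficients are zero.
  independent : ∀ S → Ideal (comb S basis) → S ≡ replicate N false
  independent S S∈I = vec-ext λ t → trans (sym (comb-coeff-basis S t))
    (trans (vanishing-std-combination (comb S basis) (comb-std S) (λ a cf → ideal-vanishes a cf (comb S basis) S∈I)
              (toPoint (plr t)) (PLR⇒conflictFree (plr t) (plr-isPLR t)))
           (sym (VP.lookup-replicate t false)))

  dimension : DimQuot (IGens r s n) N
  dimension = basis , spanning , independent

  hilbert : ∀ m → Σ ℕ λ Nm → Card (λ (P : Rc) → IsPLR P × size P ≡ m) Nm × HFis (IGens r s n) m Nm
  hilbert m = Nm , rects , card-bijection monoOf rects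
    (λ P (plr , size≡) → trans (deg-monoOf P) size≡ , std⇒standard (toPoint P) (PLR⇒conflictFree P plr))
    (λ P Q _ _ → monoOf-injective P Q)
    onto
    where
    counted = count rectangles (λ P → isPLR? P ×-dec (size P ≟ℕ m))
    Nm = proj₁ counted
    rects = proj₂ counted
    onto : ∀ μ → deg μ ≡ m × Standard (IGens r s n) μ → Σ Rc λ P → (IsPLR P × size P ≡ m) × monoOf P ≡ μ
    onto μ (deg≡ , st) with standard⇒std μ st
    ... | b , cfb , μ≡ = fromPoint b , (fromPoint-PLR b cfb , trans (sym (deg-monoOf (fromPoint b))) (trans (cong deg mono≡) deg≡)) , mono≡
      where mono≡ = trans (cong sqMono (toPoint-fromPoint b cfb)) (sym μ≡)

theorem2 : (r s n : ℕ) → 1 ≤ r → 1 ≤ s → 1 ≤ n →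
    ( ((P : Rect r s n) → IsPLR P → InV (IGens r s n) (toPoint P))
    × ((P Q : Rect r s n) → IsPLR P → IsPLR Q → toPoint P ≡ toPoint Q → P ≡ Q)
    × ((a : Point {r} {s} {n}) → InV (IGens r s n) a →
         Σ (Rect r s n) λ P → IsPLR P × toPoint P ≡ a) )
    × (Σ ℕ λ N → Card (IsPLR {r} {s} {n}) N × DimQuot (IGens r s n) N)
    × ((m : ℕ) → Σ ℕ λ N →
         Card (λ (P : Rect r s n) → IsPLR P × size P ≡ m) N × HFis (IGens r s n) m N)
theorem2 r s n _ _ _ =
  (plr-zero , (λ P Q _ _ → toPoint-injective P Q) , zero-plr) ,
  (N , proj₂ plr-count , dimension) ,
  hilbert
  where
  open Variety r s n
  open Counting r s n
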